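{- For integers $m,n\ge 0$ let $f(m,n)$ denote the number of partitions of $n$ into exactly $m$ parts such that: no part appears more than twice; any two distinct part sizes that occur differ by at least $2$; and any two distinct part sizes that each occur twice (repeated part sizes) differ by at least $3$. Then, as formal power series in $x$ and $q$, $$\sum_{m,n\ge 0} f(m,n)\,x^m q^n=\sum_{m,n\ge 0}\frac{q^{6\binom{m+1}{2}+2\binom{n+1}{2}+2mn-4m-n}\,x^{2m+n}}{(q^2;q^2)_m\,(q;q)_n}.$$
   Context: For a variable $a$ and an integer $k\ge 0$, $(a;q)_k=\prod_{j=1}^{k}(1-aq^{j-1})$ (so $(a;q)_0=1$). A partition of $n$ is an unordered sum of positive integers adding up to $n$; the empty partition is the unique partition of $0$, with $0$ parts. -}

module Defs where

open import Data.Nat as ℕ using (ℕ; zero; suc; _≡ᵇ_; _≤_; _<_; _∸_)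
open import Data.Nat.Combinatorics using (_C_)
open import Data.Integer as ℤ using (ℤ; +_; -_)
open import Data.Bool using (if_then_else_)
open import Data.List using (List; []; _∷_; length)
open import Data.Nat.ListAction using (sum)
open import Data.List.Relation.Unary.All using (All)
open import Data.List.Relation.Unary.Linked using (Linked)
open import Data.List.Membership.Propositional using (_∈_)
open import Data.Product using (_×_)
open import Relation.Binary.PropositionalEquality using (_≡_)

PS : Set
PS = ℕ → ℤ

sumTo : ℕ → (ℕ → ℤ) → ℤ
sumTo zero    f = f 0
sumTo (suc n) f = sumTo n f ℤ.+ f (suc n)

mono : ℕ → PS
mono e k = if k ≡ᵇ e then ℤ.+ 1 else ℤ.+ 0

one : PS
one = mono 0

qq : PS
qq = mono 1

_⊝_ : PS → PS → PS
(a ⊝ b) k = a k ℤ.- b k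

_⊛_ : PS → PS → PS
(a ⊛ b) n = sumTo n (λ k → a k ℤ.* b (n ∸ k))

pow : PS → ℕ → PS
pow a zero    = one
pow a (suc j) = a ⊛ pow a j

-- (a;p)_k = ∏_{j=1}^{k} (1 - a p^{j-1})
poch : PS → PS → ℕ → PS
poch a p zero    = one
poch a p (suc k) = poch a p k ⊛ (one ⊝ (a ⊛ pow p k))

-- Multiplicative inverse of a series a with a 0 = 1:
-- b 0 = 1,  b n = - Σ_{k=1}^{n} a k * b (n - k).
-- invList a n = [b n, b (n-1), ..., b 0].
private
  weighted : PS → ℕ → List ℤ → ℤ
  weighted a i []       = ℤ.+ 0
  weighted a i (b ∷ bs) = a (suc i) ℤ.* b ℤ.+ weighted a (suc i) bs

invList : PS → ℕ → List ℤ
invList a zero    = ℤ.+ 1 ∷ []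
invList a (suc n) = let bs = invList a n in (ℤ.- weighted a 0 bs) ∷ bs

inv : PS → PS
inv a n with invList a n
... | []    = ℤ.+ 0
... | b ∷ _ = b

-- exponent 6 C(m+1,2) + 2 C(n+1,2) + 2mn - 4m - n  (always ≥ 0)
expo : ℕ → ℕ → ℕ
expo m n = (6 ℕ.* (suc m C 2) ℕ.+ 2 ℕ.* (suc n C 2) ℕ.+ 2 ℕ.* m ℕ.* n) ∸ (4 ℕ.* m ℕ.+ n)

term : ℕ → ℕ → PS
term m n = mono (expo m n) ⊛ inv (poch (pow qq 2) (pow qq 2) m ⊛ poch qq qq n)

-- coefficient of x^M q^N of the RHS: sum over (m,n) with 2m + n = M
rhsCoeff : ℕ → ℕ → ℤ
rhsCoeff M N = sumTo M (λ m → sumTo M (λ n →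
  if (2 ℕ.* m ℕ.+ n) ≡ᵇ M then term m n N else ℤ.+ 0))

occ : ℕ → List ℕ → ℕ
occ k []       = 0
occ k (x ∷ xs) = if x ≡ᵇ k then suc (occ k xs) else occ k xs

IsPartitionOf : ℕ → List ℕ → Set
IsPartitionOf n p = All (λ k → 1 ≤ k) p × Linked ℕ._≥_ p × sum p ≡ n


Conditions : List ℕ → Set
Conditions p =
    (∀ k → occ k p ≤ 2)
  × (∀ a b → a ∈ p → b ∈ p → a < b → 2 ℕ.+ a ≤ b)
  × (∀ a b → 2 ≤ occ a p → 2 ≤ occ b p → a < b → 3 ℕ.+ a ≤ b)

-- Let T(m, n) = q^(expo m n) / ((q²;q²)_m (q;q)_n), the summand of the right-hand side indexed by
-- (m, n) without its factor x^(2m+n).  The coefficient of q^N in T(m, n) counts the partitions of N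
-- satisfying the conditions with m part sizes occurring twice and n occurring once; summing over
-- 2m + n = M gives the theorem.
-- Such a partition either has no part 1, and lowering every part by 1 gives one of the same kind;
-- or its smallest parts are a single 1, a repeated 1 not followed by 3, or 1 1 3, and removing them
-- and lowering the other parts by 2, 3 or 4 gives one with (m, n − 1), (m − 1, n) or (m − 1, n − 1).
-- If the smaller partition has c parts, the sum drops by c, 1 + 2c, 2 + 3c or 5 + 4c respectively.
-- T satisfies the same recurrence: once the exponents are matched, dividing it by T(m, n) leaves
--   1 = q^(i+j) + q^i (1 − q^j) + q^j (1 − q^i) + (1 − q^i) (1 − q^j)   with i = 2m, j = n.
-- Listing the partitions along this decomposition gives a duplicate-free list of the right length.

{-# OPTIONS --safe #-}
module Submission where

open import Defs
open import Data.Bool as Bool using (true; false; if_then_else_)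
open import Data.Empty using (⊥-elim)
open import Data.Integer as ℤ using (ℤ; -_; 0ℤ; 1ℤ)
import Data.Integer.Properties as ℤ
import Data.Integer.Tactic.RingSolver as ℤ-Solver
open import Data.List using (List; []; _∷_; _++_; map; length; reverse)
import Data.List.Properties as List
open import Data.List.Membership.Propositional using (_∈_)
open import Data.List.Membership.Propositional.Properties
  using (∈-++⁺ˡ; ∈-++⁺ʳ; ∈-++⁻; ∈-map⁺; ∈-map⁻)
open import Data.List.Relation.Binary.Permutation.Propositional as ↭ using (_↭_; ↭-sym)
open import Data.List.Relation.Binary.Permutation.Propositional.Properties
  using (∈-resp-↭; All-resp-↭; ↭-reverse)
open import Data.List.Relation.Unary.All as All using (All; []; _∷_)
import Data.List.Relation.Unary.All.Properties as Allₚ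
open import Data.List.Relation.Unary.AllPairs as AllPairs using (AllPairs; []; _∷_)
import Data.List.Relation.Unary.AllPairs.Properties as AllPairsₚ
open import Data.List.Relation.Unary.Any using (here; there)
open import Data.List.Relation.Unary.Linked.Properties using (AllPairs⇒Linked; Linked⇒AllPairs)
open import Data.List.Relation.Unary.Unique.Propositional using (Unique)
import Data.List.Relation.Unary.Unique.Propositional.Properties as Unique
open import Data.Nat as ℕ using (ℕ; zero; suc; _+_; _*_; _≤_; _<_; _∸_; z≤n; s≤s; _≡ᵇ_; _≟_)
import Data.Nat.Properties as ℕ
open import Data.Nat.Combinatorics using (_C_; nCk+nC[k+1]≡[n+1]C[k+1]; nC1≡n)
open import Data.Nat.Induction using (<-rec)
open import Data.Nat.ListAction using (sum)
open import Data.Nat.ListAction.Properties using (sum-++; sum-↭)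
import Data.Nat.Tactic.RingSolver as ℕ-Solver
open import Data.Product using (Σ; ∃; ∃₂; _×_; _,_; proj₁; proj₂)
open import Data.Sum using (_⊎_; inj₁; inj₂)
open import Data.Unit using (tt)
open import Function using (flip)
open import Function.Bundles using (_⇔_; mk⇔)
open import Relation.Binary.PropositionalEquality
import Relation.Binary.Reasoning.Setoid as SetoidReasoning
open import Relation.Nullary using (¬_; yes; no)

module ≗-Reasoning = SetoidReasoning (ℕ →-setoid ℤ)

-- Power series

infixr 6 _⊕_

_⊕_ : PS → PS → PS
(a ⊕ b) k = a k ℤ.+ b k

zeros : PS
zeros _ = 0ℤ

-- shift j and minusShift j are multiplication by q^j and by 1 − q^j
shift : ℕ → PS → PS
shift zero    a k       = a k
shift (suc j) a zero    = 0ℤ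
shift (suc j) a (suc k) = shift j a k

minusShift : ℕ → PS → PS
minusShift j a = a ⊝ shift j a

sumTo-cong : ∀ n {f g : ℕ → ℤ} → (∀ k → k ≤ n → f k ≡ g k) → sumTo n f ≡ sumTo n g
sumTo-cong zero    f≡g = f≡g 0 z≤n
sumTo-cong (suc n) f≡g =
  cong₂ ℤ._+_ (sumTo-cong n (λ k k≤n → f≡g k (ℕ.m≤n⇒m≤1+n k≤n))) (f≡g (suc n) ℕ.≤-refl)

sumTo-zero : ∀ n {f : ℕ → ℤ} → (∀ k → k ≤ n → f k ≡ 0ℤ) → sumTo n f ≡ 0ℤ
sumTo-zero zero    f≡0 = f≡0 0 z≤n
sumTo-zero (suc n) f≡0 =
  cong₂ ℤ._+_ (sumTo-zero n (λ k k≤n → f≡0 k (ℕ.m≤n⇒m≤1+n k≤n))) (f≡0 (suc n) ℕ.≤-refl)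

sumTo-unfoldˡ : ∀ n f → sumTo (suc n) f ≡ f 0 ℤ.+ sumTo n (λ k → f (suc k))
sumTo-unfoldˡ zero    f = refl
sumTo-unfoldˡ (suc n) f =
  trans (cong (ℤ._+ f (suc (suc n))) (sumTo-unfoldˡ n f)) (ℤ.+-assoc (f 0) _ _)

sumTo-reverse : ∀ n f → sumTo n f ≡ sumTo n (λ k → f (n ∸ k))
sumTo-reverse zero    f = refl
sumTo-reverse (suc n) f = begin
  sumTo n f ℤ.+ f (suc n)                   ≡⟨ cong (ℤ._+ f (suc n)) (sumTo-reverse n f) ⟩
  sumTo n (λ k → f (n ∸ k)) ℤ.+ f (suc n)   ≡⟨ ℤ.+-comm _ (f (suc n)) ⟩
  f (suc n) ℤ.+ sumTo n (λ k → f (n ∸ k))   ≡⟨ sumTo-unfoldˡ n (λ k → f (suc n ∸ k)) ⟨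
  sumTo (suc n) (λ k → f (suc n ∸ k))       ∎
  where open ≡-Reasoning

sumTo-⊝ : ∀ n f g → sumTo n (λ k → f k ℤ.- g k) ≡ sumTo n f ℤ.- sumTo n g
sumTo-⊝ zero    f g = refl
sumTo-⊝ (suc n) f g =
  trans (cong (ℤ._+ (f (suc n) ℤ.- g (suc n))) (sumTo-⊝ n f g))
        (interchange (sumTo n f) (sumTo n g) (f (suc n)) (g (suc n)))
  where
  interchange : ∀ a b c d → (a ℤ.- b) ℤ.+ (c ℤ.- d) ≡ (a ℤ.+ c) ℤ.- (b ℤ.+ d)
  interchange = ℤ-Solver.solve-∀

⊕-cong : ∀ {a a' b b'} → a ≗ a' → b ≗ b' → (a ⊕ b) ≗ (a' ⊕ b')
⊕-cong a≗a' b≗b' k = cong₂ ℤ._+_ (a≗a' k) (b≗b' k)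

⊝-cong : ∀ {a a' b b'} → a ≗ a' → b ≗ b' → (a ⊝ b) ≗ (a' ⊝ b')
⊝-cong a≗a' b≗b' k = cong₂ ℤ._-_ (a≗a' k) (b≗b' k)

⊛-cong : ∀ {a a' b b'} → a ≗ a' → b ≗ b' → (a ⊛ b) ≗ (a' ⊛ b')
⊛-cong a≗a' b≗b' n = sumTo-cong n (λ k _ → cong₂ ℤ._*_ (a≗a' k) (b≗b' (n ∸ k)))

⊛-congˡ : ∀ {a a'} b → a ≗ a' → (a ⊛ b) ≗ (a' ⊛ b)
⊛-congˡ b a≗a' = ⊛-cong {b = b} a≗a' (λ _ → refl)

⊛-congʳ : ∀ a {b b'} → b ≗ b' → (a ⊛ b) ≗ (a ⊛ b')
⊛-congʳ a b≗b' = ⊛-cong {a = a} (λ _ → refl) b≗b'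

⊕-congʳ : ∀ a {b b'} → b ≗ b' → (a ⊕ b) ≗ (a ⊕ b')
⊕-congʳ a b≗b' = ⊕-cong {a = a} (λ _ → refl) b≗b'

⊝-congʳ : ∀ a {b b'} → b ≗ b' → (a ⊝ b) ≗ (a ⊝ b')
⊝-congʳ a b≗b' = ⊝-cong {a = a} (λ _ → refl) b≗b'

shift-cong : ∀ j {a b} → a ≗ b → shift j a ≗ shift j b
shift-cong zero    a≗b k       = a≗b k
shift-cong (suc j) a≗b zero    = refl
shift-cong (suc j) a≗b (suc k) = shift-cong j a≗b k

minusShift-cong : ∀ j {a b} → a ≗ b → minusShift j a ≗ minusShift j b
minusShift-cong j a≗b = ⊝-cong a≗b (shift-cong j a≗b)

shift-shift : ∀ i j a → shift i (shift j a) ≗ shift (i + j) a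
shift-shift zero    j a k       = refl
shift-shift (suc i) j a zero    = refl
shift-shift (suc i) j a (suc k) = shift-shift i j a k

shift-⊝ : ∀ j a b → shift j (a ⊝ b) ≗ (shift j a ⊝ shift j b)
shift-⊝ zero    a b k       = refl
shift-⊝ (suc j) a b zero    = refl
shift-⊝ (suc j) a b (suc k) = shift-⊝ j a b k

shift-minusShift : ∀ k j a → shift k (minusShift j a) ≗ minusShift j (shift k a)
shift-minusShift k j a i = trans (shift-⊝ k a (shift j a) i) (cong (λ x → shift k a i ℤ.- x) (begin
  shift k (shift j a) i   ≡⟨ shift-shift k j a i ⟩
  shift (k + j) a i     ≡⟨ cong (λ e → shift e a i) (ℕ.+-comm k j) ⟩
  shift (j + k) a i     ≡⟨ shift-shift j k a i ⟨
  shift j (shift k a) i   ∎))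
  where open ≡-Reasoning

⊛-comm : ∀ a b → (a ⊛ b) ≗ (b ⊛ a)
⊛-comm a b n = trans (sumTo-reverse n _) (sumTo-cong n λ k k≤n →
  trans (cong (λ i → a (n ∸ k) ℤ.* b i) (ℕ.m∸[m∸n]≡n k≤n)) (ℤ.*-comm (a (n ∸ k)) (b k)))

⊛-distribʳ-⊝ : ∀ a b c → ((a ⊝ b) ⊛ c) ≗ ((a ⊛ c) ⊝ (b ⊛ c))
⊛-distribʳ-⊝ a b c n =
  trans (sumTo-cong n (λ k _ → distrib (a k) (b k) (c (n ∸ k)))) (sumTo-⊝ n _ _)
  where
  distrib : ∀ x y z → (x ℤ.- y) ℤ.* z ≡ x ℤ.* z ℤ.- y ℤ.* z
  distrib = ℤ-Solver.solve-∀

shift-⊛ : ∀ j a b → (shift j a ⊛ b) ≗ shift j (a ⊛ b)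
shift-⊛ zero    a b n       = refl
shift-⊛ (suc j) a b zero    = refl
shift-⊛ (suc j) a b (suc n) =
  trans (sumTo-unfoldˡ n _) (trans (ℤ.+-identityˡ _) (shift-⊛ j a b n))

one-⊛ : ∀ a → (one ⊛ a) ≗ a
one-⊛ a zero    = ℤ.*-identityˡ (a 0)
one-⊛ a (suc n) = begin
  sumTo (suc n) (λ k → one k ℤ.* a (suc n ∸ k))            ≡⟨ sumTo-unfoldˡ n _ ⟩
  1ℤ ℤ.* a (suc n) ℤ.+ sumTo n (λ _ → 0ℤ)
    ≡⟨ cong₂ ℤ._+_ (ℤ.*-identityˡ (a (suc n))) (sumTo-zero n (λ _ _ → refl)) ⟩
  a (suc n) ℤ.+ 0ℤ                                         ≡⟨ ℤ.+-identityʳ _ ⟩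
  a (suc n)                                                ∎
  where open ≡-Reasoning

⊛-one : ∀ a → (a ⊛ one) ≗ a
⊛-one a n = trans (⊛-comm a one n) (one-⊛ a n)

⊛-distribˡ-⊝ : ∀ a b c → (a ⊛ (b ⊝ c)) ≗ ((a ⊛ b) ⊝ (a ⊛ c))
⊛-distribˡ-⊝ a b c n = begin
  (a ⊛ (b ⊝ c)) n             ≡⟨ ⊛-comm a (b ⊝ c) n ⟩
  ((b ⊝ c) ⊛ a) n             ≡⟨ ⊛-distribʳ-⊝ b c a n ⟩
  ((b ⊛ a) ⊝ (c ⊛ a)) n       ≡⟨ ⊝-cong (⊛-comm b a) (⊛-comm c a) n ⟩
  ((a ⊛ b) ⊝ (a ⊛ c)) n       ∎
  where open ≡-Reasoning

minusShift-⊛ : ∀ j a b → (minusShift j a ⊛ b) ≗ minusShift j (a ⊛ b)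
minusShift-⊛ j a b n =
  trans (⊛-distribʳ-⊝ a (shift j a) b n) (cong (λ x → (a ⊛ b) n ℤ.- x) (shift-⊛ j a b n))

⊛-minusShift : ∀ j a b → (a ⊛ minusShift j b) ≗ minusShift j (a ⊛ b)
⊛-minusShift j a b n = begin
  (a ⊛ minusShift j b) n      ≡⟨ ⊛-comm a (minusShift j b) n ⟩
  (minusShift j b ⊛ a) n      ≡⟨ minusShift-⊛ j b a n ⟩
  minusShift j (b ⊛ a) n      ≡⟨ minusShift-cong j (⊛-comm b a) n ⟩
  minusShift j (a ⊛ b) n      ∎
  where open ≡-Reasoning

mono≗shift-one : ∀ j → mono j ≗ shift j one
mono≗shift-one zero    k       = refl
mono≗shift-one (suc j) zero    = refl
mono≗shift-one (suc j) (suc k) = mono≗shift-one j k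

mono-⊛ : ∀ j a → (mono j ⊛ a) ≗ shift j a
mono-⊛ j a n = begin
  (mono j ⊛ a) n          ≡⟨ ⊛-congˡ a (mono≗shift-one j) n ⟩
  (shift j one ⊛ a) n     ≡⟨ shift-⊛ j one a n ⟩
  shift j (one ⊛ a) n     ≡⟨ shift-cong j (one-⊛ a) n ⟩
  shift j a n             ∎
  where open ≡-Reasoning

pow-mono : ∀ {a} j → a ≗ mono j → ∀ k → pow a k ≗ mono (k * j)
pow-mono j a≗qʲ zero    n = refl
pow-mono {a} j a≗qʲ (suc k) n = begin
  (a ⊛ pow a k) n                 ≡⟨ ⊛-cong a≗qʲ (pow-mono j a≗qʲ k) n ⟩
  (mono j ⊛ mono (k * j)) n     ≡⟨ mono-⊛ j _ n ⟩
  shift j (mono (k * j)) n      ≡⟨ shift-cong j (mono≗shift-one (k * j)) n ⟩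
  shift j (shift (k * j) one) n ≡⟨ shift-shift j (k * j) one n ⟩
  shift (suc k * j) one n       ≡⟨ mono≗shift-one (suc k * j) n ⟨
  mono (suc k * j) n            ∎
  where open ≡-Reasoning

-- `invList` is built from a helper that Defs keeps private.  It is recovered by unification:
-- once `invList a n` and `0` are abstracted, the constraint below is a pattern.
mutual
  private
    weighted : PS → ℕ → List ℤ → ℤ
    weighted = _

  inv-suc-weighted : ∀ a n → inv a (suc n) ≡ - weighted a 0 (invList a n)
  inv-suc-weighted a n with invList a n | 0
  ... | bs | i = refl

weighted-invList : ∀ a i n →
  weighted a i (invList a n) ≡ sumTo n (λ k → a (suc (i + k)) ℤ.* inv a (n ∸ k))
weighted-invList a i zero =
  trans (ℤ.+-identityʳ _) (cong (λ e → a (suc e) ℤ.* 1ℤ) (sym (ℕ.+-identityʳ i)))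
weighted-invList a i (suc n) = begin
  a (suc i) ℤ.* inv a (suc n) ℤ.+ weighted a (suc i) (invList a n)
    ≡⟨ cong₂ ℤ._+_ (cong (λ e → a (suc e) ℤ.* inv a (suc n)) (sym (ℕ.+-identityʳ i)))
                   (weighted-invList a (suc i) n) ⟩
  a (suc (i + 0)) ℤ.* inv a (suc n) ℤ.+ sumTo n (λ k → a (suc (suc i + k)) ℤ.* inv a (n ∸ k))
    ≡⟨ cong (λ x → a (suc (i + 0)) ℤ.* inv a (suc n) ℤ.+ x)
            (sumTo-cong n (λ k _ → cong (λ e → a (suc e) ℤ.* inv a (n ∸ k)) (sym (ℕ.+-suc i k)))) ⟩
  a (suc (i + 0)) ℤ.* inv a (suc n) ℤ.+ sumTo n (λ k → a (suc (i + suc k)) ℤ.* inv a (n ∸ k))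
    ≡⟨ sumTo-unfoldˡ n _ ⟨
  sumTo (suc n) (λ k → a (suc (i + k)) ℤ.* inv a (suc n ∸ k))
    ∎
  where open ≡-Reasoning

inv-suc : ∀ a n → inv a (suc n) ≡ - sumTo n (λ k → a (suc k) ℤ.* inv a (n ∸ k))
inv-suc a n = trans (inv-suc-weighted a n) (cong -_ (weighted-invList a 0 n))

⊛-inverseʳ : ∀ a → a 0 ≡ 1ℤ → (a ⊛ inv a) ≗ one
⊛-inverseʳ a a₀≡1 zero    = cong (ℤ._* 1ℤ) a₀≡1
⊛-inverseʳ a a₀≡1 (suc n) = begin
  sumTo (suc n) (λ k → a k ℤ.* inv a (suc n ∸ k))  ≡⟨ sumTo-unfoldˡ n _ ⟩
  a 0 ℤ.* inv a (suc n) ℤ.+ s                       ≡⟨ cong₂ (λ x y → x ℤ.* y ℤ.+ s) a₀≡1 (inv-suc a n) ⟩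
  1ℤ ℤ.* (- s) ℤ.+ s                                ≡⟨ cancel s ⟩
  0ℤ                                                ∎
  where
  open ≡-Reasoning
  s = sumTo n (λ k → a (suc k) ℤ.* inv a (n ∸ k))
  cancel : ∀ x → 1ℤ ℤ.* (- x) ℤ.+ x ≡ 0ℤ
  cancel = ℤ-Solver.solve-∀

⊛-cancelˡ-zeros : ∀ a d → a 0 ≡ 1ℤ → (a ⊛ d) ≗ zeros → d ≗ zeros
⊛-cancelˡ-zeros a d a₀≡1 ad≗0 = <-rec _ step
  where
  step : ∀ n → (∀ {k} → k < n → d k ≡ 0ℤ) → d n ≡ 0ℤ
  step zero    _  = trans (sym (trans (cong (ℤ._* d 0) a₀≡1) (ℤ.*-identityˡ (d 0)))) (ad≗0 0)
  step (suc n) ih = begin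
    d (suc n)                                               ≡⟨ ℤ.+-identityʳ _ ⟨
    d (suc n) ℤ.+ 0ℤ                                       ≡⟨ cong₂ ℤ._+_ a₀d≡d (sym tail≡0) ⟩
    a 0 ℤ.* d (suc n) ℤ.+ sumTo n (λ k → a (suc k) ℤ.* d (n ∸ k)) ≡⟨ sumTo-unfoldˡ n _ ⟨
    (a ⊛ d) (suc n)                                         ≡⟨ ad≗0 (suc n) ⟩
    0ℤ                                                     ∎
    where
    open ≡-Reasoning
    a₀d≡d : d (suc n) ≡ a 0 ℤ.* d (suc n)
    a₀d≡d = sym (trans (cong (ℤ._* d (suc n)) a₀≡1) (ℤ.*-identityˡ _))
    tail≡0 : sumTo n (λ k → a (suc k) ℤ.* d (n ∸ k)) ≡ 0ℤ
    tail≡0 = sumTo-zero n (λ k _ →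
      trans (cong (a (suc k) ℤ.*_) (ih (s≤s (ℕ.m∸n≤m n k)))) (ℤ.*-zeroʳ (a (suc k))))

inv-unique : ∀ a b → a 0 ≡ 1ℤ → (a ⊛ b) ≗ one → b ≗ inv a
inv-unique a b a₀≡1 ab≗1 n =
  ℤ.i-j≡0⇒i≡j (b n) (inv a n) (⊛-cancelˡ-zeros a (b ⊝ inv a) a₀≡1 a[b-a⁻¹]≗0 n)
  where
  a[b-a⁻¹]≗0 : (a ⊛ (b ⊝ inv a)) ≗ zeros
  a[b-a⁻¹]≗0 k = trans (⊛-distribˡ-⊝ a b (inv a) k)
    (trans (cong₂ ℤ._-_ (ab≗1 k) (⊛-inverseʳ a a₀≡1 k)) (ℤ.+-inverseʳ (one k)))

inv-minusShift : ∀ j a a' → a 0 ≡ 1ℤ → a' 0 ≡ 1ℤ → a' ≗ minusShift j a →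
                 inv a ≗ minusShift j (inv a')
inv-minusShift j a a' a₀≡1 a'₀≡1 a'≗[1-qʲ]a n =
  sym (inv-unique a (minusShift j (inv a')) a₀≡1 product n)
  where
  product : (a ⊛ minusShift j (inv a')) ≗ one
  product k = begin
    (a ⊛ minusShift j (inv a')) k    ≡⟨ ⊛-minusShift j a (inv a') k ⟩
    minusShift j (a ⊛ inv a') k      ≡⟨ minusShift-⊛ j a (inv a') k ⟨
    (minusShift j a ⊛ inv a') k      ≡⟨ ⊛-congˡ (inv a') a'≗[1-qʲ]a k ⟨
    (a' ⊛ inv a') k                  ≡⟨ ⊛-inverseʳ a' a'₀≡1 k ⟩
    one k                            ∎
    where open ≡-Reasoning

poch-suc : ∀ {a p} k j → (a ⊛ pow p k) ≗ mono j → poch a p (suc k) ≗ minusShift j (poch a p k)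
poch-suc {a} {p} k j apᵏ≗qʲ n = begin
  (P ⊛ (one ⊝ (a ⊛ pow p k))) n     ≡⟨ ⊛-congʳ P (⊝-congʳ one apᵏ≗qʲ) n ⟩
  (P ⊛ (one ⊝ mono j)) n            ≡⟨ ⊛-congʳ P (⊝-congʳ one (mono≗shift-one j)) n ⟩
  (P ⊛ minusShift j one) n          ≡⟨ ⊛-minusShift j P one n ⟩
  minusShift j (P ⊛ one) n          ≡⟨ minusShift-cong j (⊛-one P) n ⟩
  minusShift j P n                  ∎
  where
  open ≡-Reasoning
  P = poch a p k

poch-constant : ∀ {a} p → a 0 ≡ 0ℤ → ∀ k → poch a p k 0 ≡ 1ℤ
poch-constant p a₀≡0 zero    = refl
poch-constant {a} p a₀≡0 (suc k) =
  cong₂ (λ x y → x ℤ.* (1ℤ ℤ.- y ℤ.* pow p k 0)) (poch-constant p a₀≡0 k) a₀≡0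

denominator : ℕ → ℕ → PS
denominator m n = poch (pow qq 2) (pow qq 2) m ⊛ poch qq qq n

denominator-constant : ∀ m n → denominator m n 0 ≡ 1ℤ
denominator-constant m n =
  cong₂ ℤ._*_ (poch-constant (pow qq 2) refl m) (poch-constant qq refl n)

denominator-sucʳ : ∀ m n → denominator m (suc n) ≗ minusShift (suc n) (denominator m n)
denominator-sucʳ m n k = begin
  (Q ⊛ poch qq qq (suc n)) k              ≡⟨ ⊛-congʳ Q (poch-suc n (suc n) qⁿ⁺¹) k ⟩
  (Q ⊛ minusShift (suc n) (poch qq qq n)) k ≡⟨ ⊛-minusShift (suc n) Q (poch qq qq n) k ⟩
  minusShift (suc n) (denominator m n) k  ∎
  where
  open ≡-Reasoning
  Q = poch (pow qq 2) (pow qq 2) m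
  qⁿ⁺¹ : pow qq (suc n) ≗ mono (suc n)
  qⁿ⁺¹ i = trans (pow-mono 1 (λ _ → refl) (suc n) i) (cong (λ e → mono e i) (ℕ.*-identityʳ (suc n)))

denominator-sucˡ : ∀ m n → denominator (suc m) n ≗ minusShift (2 * suc m) (denominator m n)
denominator-sucˡ m n k = begin
  (poch q² q² (suc m) ⊛ R) k                 ≡⟨ ⊛-congˡ R (poch-suc m (2 * suc m) q²⁽ᵐ⁺¹⁾) k ⟩
  (minusShift (2 * suc m) (poch q² q² m) ⊛ R) k ≡⟨ minusShift-⊛ (2 * suc m) (poch q² q² m) R k ⟩
  minusShift (2 * suc m) (denominator m n) k ∎
  where
  open ≡-Reasoning
  q² = pow qq 2
  R = poch qq qq n
  q²⁽ᵐ⁺¹⁾ : pow q² (suc m) ≗ mono (2 * suc m)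
  q²⁽ᵐ⁺¹⁾ i = trans (pow-mono 2 (pow-mono 1 (λ _ → refl) 2) (suc m) i)
                    (cong (λ e → mono e i) (ℕ.*-comm (suc m) 2))

denominator⁻¹ : ℕ → ℕ → PS
denominator⁻¹ m n = inv (denominator m n)

denominator⁻¹-sucʳ : ∀ m n → denominator⁻¹ m n ≗ minusShift (suc n) (denominator⁻¹ m (suc n))
denominator⁻¹-sucʳ m n = inv-minusShift (suc n) (denominator m n) (denominator m (suc n))
  (denominator-constant m n) (denominator-constant m (suc n)) (denominator-sucʳ m n)

denominator⁻¹-sucˡ : ∀ m n → denominator⁻¹ m n ≗ minusShift (2 * suc m) (denominator⁻¹ (suc m) n)
denominator⁻¹-sucˡ m n = inv-minusShift (2 * suc m) (denominator m n) (denominator (suc m) n)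
  (denominator-constant m n) (denominator-constant (suc m) n) (denominator-sucˡ m n)

term≗shift : ∀ m n → term m n ≗ shift (expo m n) (denominator⁻¹ m n)
term≗shift m n = mono-⊛ (expo m n) (denominator⁻¹ m n)

-- The exponent and the recurrence

parts : ℕ → ℕ → ℕ
parts m n = 2 * m + n

2*[1+n]C2≡n*[1+n] : ∀ n → 2 * (suc n C 2) ≡ n * suc n
2*[1+n]C2≡n*[1+n] zero    = refl
2*[1+n]C2≡n*[1+n] (suc n) = begin
  2 * (suc (suc n) C 2)             ≡⟨ cong (2 *_) (nCk+nC[k+1]≡[n+1]C[k+1] (suc n) 1) ⟨
  2 * (suc n C 1 + suc n C 2)       ≡⟨ ℕ.*-distribˡ-+ 2 (suc n C 1) (suc n C 2) ⟩
  2 * (suc n C 1) + 2 * (suc n C 2)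
    ≡⟨ cong₂ (λ x y → 2 * x + y) (nC1≡n (suc n)) (2*[1+n]C2≡n*[1+n] n) ⟩
  2 * suc n + n * suc n             ≡⟨ poly n ⟩
  suc n * suc (suc n)               ∎
  where
  open ≡-Reasoning
  poly : ∀ n → 2 * suc n + n * suc n ≡ suc n * suc (suc n)
  poly = ℕ-Solver.solve-∀

private
  ∸-eq : ∀ {x} k {y} → x ≡ k + y → x ∸ k ≡ y
  ∸-eq k {y} refl = ℕ.m+n∸m≡n k y

  expo-unfold : ∀ m n → expo m n ≡ (3 * (m * suc m) + n * suc n + 2 * m * n) ∸ (4 * m + n)
  expo-unfold m n = cong (_∸ (4 * m + n)) (cong₂ (λ x y → x + y + 2 * m * n)
    (trans (ℕ.*-assoc 3 2 (suc m C 2)) (cong (3 *_) (2*[1+n]C2≡n*[1+n] m))) (2*[1+n]C2≡n*[1+n] n))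

-- expo m n = 3m² − m + n² + 2mn, stated without subtraction
expo-closed : ∀ m n → expo m n + m ≡ 3 * m * m + n * n + 2 * m * n
expo-closed zero n = trans (ℕ.+-identityʳ (expo 0 n)) (trans (expo-unfold 0 n) (∸-eq (4 * 0 + n) (poly n)))
  where
  poly : ∀ n → 3 * (0 * 1) + n * suc n + 2 * 0 * n ≡ (4 * 0 + n) + (3 * 0 * 0 + n * n + 2 * 0 * n)
  poly = ℕ-Solver.solve-∀
expo-closed (suc m) n =
  trans (cong (_+ suc m) (trans (expo-unfold (suc m) n) (∸-eq (4 * suc m + n) (unfolded m n)))) (closed m n)
  where
  unfolded : ∀ m n → 3 * (suc m * suc (suc m)) + n * suc n + 2 * suc m * n
                   ≡ (4 * suc m + n) + (3 * m * m + 5 * m + 2 + n * n + 2 * suc m * n)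
  unfolded = ℕ-Solver.solve-∀
  closed : ∀ m n → 3 * m * m + 5 * m + 2 + n * n + 2 * suc m * n + suc m
                 ≡ 3 * suc m * suc m + n * n + 2 * suc m * n
  closed = ℕ-Solver.solve-∀

expo-relation : ∀ m n m' n' x y →
  x + (3 * m * m + n * n + 2 * m * n) + m' ≡ y + (3 * m' * m' + n' * n' + 2 * m' * n') + m →
  x + expo m n ≡ y + expo m' n'
expo-relation m n m' n' x y closed = ℕ.+-cancelʳ-≡ (m + m') _ _ (begin
  x + expo m n + (m + m')     ≡⟨ regroup x (expo m n) m m' ⟩
  x + (expo m n + m) + m'     ≡⟨ cong (λ e → x + e + m') (expo-closed m n) ⟩
  x + (3 * m * m + n * n + 2 * m * n) + m'       ≡⟨ closed ⟩
  y + (3 * m' * m' + n' * n' + 2 * m' * n') + m  ≡⟨ cong (λ e → y + e + m) (expo-closed m' n') ⟨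
  y + (expo m' n' + m') + m   ≡⟨ regroup' y (expo m' n') m m' ⟩
  y + expo m' n' + (m + m')   ∎)
  where
  open ≡-Reasoning
  regroup : ∀ x e a b → x + e + (a + b) ≡ x + (e + a) + b
  regroup = ℕ-Solver.solve-∀
  regroup' : ∀ y e a b → y + (e + b) + a ≡ y + e + (a + b)
  regroup' = ℕ-Solver.solve-∀

expo-sucʳ : ∀ m n → (1 + 2 * parts m n) + expo m n ≡ 2 * m + expo m (suc n)
expo-sucʳ m n = expo-relation m n m (suc n) _ _ (poly m n)
  where
  poly : ∀ m n → (1 + 2 * (2 * m + n)) + (3 * m * m + n * n + 2 * m * n) + m
               ≡ 2 * m + (3 * m * m + suc n * suc n + 2 * m * suc n) + m
  poly = ℕ-Solver.solve-∀

expo-sucˡ : ∀ m n → (2 + 3 * parts m n) + expo m n ≡ n + expo (suc m) n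
expo-sucˡ m n = expo-relation m n (suc m) n _ _ (poly m n)
  where
  poly : ∀ m n → (2 + 3 * (2 * m + n)) + (3 * m * m + n * n + 2 * m * n) + suc m
               ≡ n + (3 * suc m * suc m + n * n + 2 * suc m * n) + m
  poly = ℕ-Solver.solve-∀

expo-suc² : ∀ m n → (5 + 4 * parts m n) + expo m n ≡ expo (suc m) (suc n)
expo-suc² m n = expo-relation m n (suc m) (suc n) _ 0 (poly m n)
  where
  poly : ∀ m n → (5 + 4 * (2 * m + n)) + (3 * m * m + n * n + 2 * m * n) + suc m
               ≡ 0 + (3 * suc m * suc m + suc n * suc n + 2 * suc m * suc n) + m
  poly = ℕ-Solver.solve-∀

shift-≡ : ∀ {i j} a → i ≡ j → shift i a ≗ shift j a
shift-≡ a i≡j k = cong (λ e → shift e a k) i≡j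

split-shift : ∀ j a → a ≗ shift j a ⊕ minusShift j a
split-shift j a k = poly (a k) (shift j a k)
  where
  poly : ∀ x y → x ≡ y ℤ.+ (x ℤ.- y)
  poly = ℤ-Solver.solve-∀

split-shift² : ∀ i j a →
  a ≗ shift (i + j) a ⊕ minusShift j (shift i a) ⊕ minusShift i (shift j a) ⊕ minusShift i (minusShift j a)
split-shift² i j a k = sym (begin
  xᵢⱼ ℤ.+ ((xᵢ ℤ.- shift j (shift i a) k) ℤ.+ ((xⱼ ℤ.- shift i (shift j a) k)
      ℤ.+ ((x ℤ.- xⱼ) ℤ.- shift i (a ⊝ shift j a) k)))
    ≡⟨ cong₂ (λ u v → xᵢⱼ ℤ.+ ((xᵢ ℤ.- u) ℤ.+ ((xⱼ ℤ.- v) ℤ.+ ((x ℤ.- xⱼ) ℤ.- shift i (a ⊝ shift j a) k))))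
             qʲqⁱ≡qⁱ⁺ʲ (shift-shift i j a k) ⟩
  xᵢⱼ ℤ.+ ((xᵢ ℤ.- xᵢⱼ) ℤ.+ ((xⱼ ℤ.- xᵢⱼ) ℤ.+ ((x ℤ.- xⱼ) ℤ.- shift i (a ⊝ shift j a) k)))
    ≡⟨ cong (λ w → xᵢⱼ ℤ.+ ((xᵢ ℤ.- xᵢⱼ) ℤ.+ ((xⱼ ℤ.- xᵢⱼ) ℤ.+ ((x ℤ.- xⱼ) ℤ.- w))))
            (trans (shift-⊝ i a (shift j a) k) (cong (λ w → xᵢ ℤ.- w) (shift-shift i j a k))) ⟩
  xᵢⱼ ℤ.+ ((xᵢ ℤ.- xᵢⱼ) ℤ.+ ((xⱼ ℤ.- xᵢⱼ) ℤ.+ ((x ℤ.- xⱼ) ℤ.- (xᵢ ℤ.- xᵢⱼ))))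
    ≡⟨ poly x xᵢ xⱼ xᵢⱼ ⟩
  x ∎)
  where
  open ≡-Reasoning
  x = a k
  xᵢ = shift i a k
  xⱼ = shift j a k
  xᵢⱼ = shift (i + j) a k
  qʲqⁱ≡qⁱ⁺ʲ : shift j (shift i a) k ≡ xᵢⱼ
  qʲqⁱ≡qⁱ⁺ʲ = trans (shift-shift j i a k) (cong (λ e → shift e a k) (ℕ.+-comm j i))
  poly : ∀ x xᵢ xⱼ xᵢⱼ →
    xᵢⱼ ℤ.+ ((xᵢ ℤ.- xᵢⱼ) ℤ.+ ((xⱼ ℤ.- xᵢⱼ) ℤ.+ ((x ℤ.- xⱼ) ℤ.- (xᵢ ℤ.- xᵢⱼ)))) ≡ x
  poly = ℤ-Solver.solve-∀

shift-term-sucʳ : ∀ m n →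
  shift (1 + 2 * parts m n) (term m n) ≗ minusShift (suc n) (shift (2 * m) (term m (suc n)))
shift-term-sucʳ m n = begin
  shift s (term m n)                              ≈⟨ shift-cong s (term≗shift m n) ⟩
  shift s (shift (expo m n) I)                    ≈⟨ shift-shift s (expo m n) I ⟩
  shift (s + expo m n) I                          ≈⟨ shift-≡ I (expo-sucʳ m n) ⟩
  shift e I                                       ≈⟨ shift-cong e (denominator⁻¹-sucʳ m n) ⟩
  shift e (minusShift (suc n) I₁)                 ≈⟨ shift-minusShift e (suc n) I₁ ⟩
  minusShift (suc n) (shift e I₁)
    ≈⟨ minusShift-cong (suc n) (shift-shift (2 * m) (expo m (suc n)) I₁) ⟨
  minusShift (suc n) (shift (2 * m) (shift (expo m (suc n)) I₁))
    ≈⟨ minusShift-cong (suc n) (shift-cong (2 * m) (term≗shift m (suc n))) ⟨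
  minusShift (suc n) (shift (2 * m) (term m (suc n))) ∎
  where
  open ≗-Reasoning
  s = 1 + 2 * parts m n
  e = 2 * m + expo m (suc n)
  I = denominator⁻¹ m n
  I₁ = denominator⁻¹ m (suc n)

shift-term-sucˡ : ∀ m n →
  shift (2 + 3 * parts m n) (term m n) ≗ minusShift (2 * suc m) (shift n (term (suc m) n))
shift-term-sucˡ m n = begin
  shift s (term m n)                              ≈⟨ shift-cong s (term≗shift m n) ⟩
  shift s (shift (expo m n) I)                    ≈⟨ shift-shift s (expo m n) I ⟩
  shift (s + expo m n) I                          ≈⟨ shift-≡ I (expo-sucˡ m n) ⟩
  shift e I                                       ≈⟨ shift-cong e (denominator⁻¹-sucˡ m n) ⟩
  shift e (minusShift (2 * suc m) I₁)             ≈⟨ shift-minusShift e (2 * suc m) I₁ ⟩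
  minusShift (2 * suc m) (shift e I₁)
    ≈⟨ minusShift-cong (2 * suc m) (shift-shift n (expo (suc m) n) I₁) ⟨
  minusShift (2 * suc m) (shift n (shift (expo (suc m) n) I₁))
    ≈⟨ minusShift-cong (2 * suc m) (shift-cong n (term≗shift (suc m) n)) ⟨
  minusShift (2 * suc m) (shift n (term (suc m) n)) ∎
  where
  open ≗-Reasoning
  s = 2 + 3 * parts m n
  e = n + expo (suc m) n
  I = denominator⁻¹ m n
  I₁ = denominator⁻¹ (suc m) n

shift-term-suc² : ∀ m n →
  shift (5 + 4 * parts m n) (term m n) ≗ minusShift (2 * suc m) (minusShift (suc n) (term (suc m) (suc n)))
shift-term-suc² m n = begin
  shift s (term m n)                              ≈⟨ shift-cong s (term≗shift m n) ⟩
  shift s (shift (expo m n) I)                    ≈⟨ shift-shift s (expo m n) I ⟩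
  shift (s + expo m n) I                          ≈⟨ shift-≡ I (expo-suc² m n) ⟩
  shift e I                                       ≈⟨ shift-cong e (denominator⁻¹-sucˡ m n) ⟩
  shift e (minusShift (2 * suc m) I₁)
    ≈⟨ shift-cong e (minusShift-cong (2 * suc m) (denominator⁻¹-sucʳ (suc m) n)) ⟩
  shift e (minusShift (2 * suc m) (minusShift (suc n) I₂))
    ≈⟨ shift-minusShift e (2 * suc m) (minusShift (suc n) I₂) ⟩
  minusShift (2 * suc m) (shift e (minusShift (suc n) I₂))
    ≈⟨ minusShift-cong (2 * suc m) (shift-minusShift e (suc n) I₂) ⟩
  minusShift (2 * suc m) (minusShift (suc n) (shift e I₂))
    ≈⟨ minusShift-cong (2 * suc m) (minusShift-cong (suc n) (term≗shift (suc m) (suc n))) ⟨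
  minusShift (2 * suc m) (minusShift (suc n) (term (suc m) (suc n))) ∎
  where
  open ≗-Reasoning
  s = 5 + 4 * parts m n
  e = expo (suc m) (suc n)
  I = denominator⁻¹ m n
  I₁ = denominator⁻¹ (suc m) n
  I₂ = denominator⁻¹ (suc m) (suc n)

term-recurrence-0-suc : ∀ n →
  term 0 (suc n) ≗ shift (parts 0 (suc n)) (term 0 (suc n)) ⊕ shift (1 + 2 * parts 0 n) (term 0 n)
term-recurrence-0-suc n = begin
  T                                             ≈⟨ split-shift (suc n) T ⟩
  shift (suc n) T ⊕ minusShift (suc n) T        ≈⟨ ⊕-congʳ (shift (suc n) T) (shift-term-sucʳ 0 n) ⟨
  shift (suc n) T ⊕ shift (1 + 2 * parts 0 n) (term 0 n) ∎
  where
  open ≗-Reasoning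
  T = term 0 (suc n)

term-recurrence-suc-0 : ∀ m →
  term (suc m) 0 ≗ shift (parts (suc m) 0) (term (suc m) 0) ⊕ shift (2 + 3 * parts m 0) (term m 0)
term-recurrence-suc-0 m = begin
  T                                                 ≈⟨ split-shift (2 * suc m) T ⟩
  shift (2 * suc m) T ⊕ minusShift (2 * suc m) T
    ≈⟨ ⊕-cong (shift-≡ T (ℕ.+-identityʳ (2 * suc m))) (shift-term-sucˡ m 0) ⟨
  shift (parts (suc m) 0) T ⊕ shift (2 + 3 * parts m 0) (term m 0) ∎
  where
  open ≗-Reasoning
  T = term (suc m) 0

term-recurrence-suc-suc : ∀ m n →
  term (suc m) (suc n) ≗ shift (parts (suc m) (suc n)) (term (suc m) (suc n))
                       ⊕ shift (1 + 2 * parts (suc m) n) (term (suc m) n)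
                       ⊕ shift (2 + 3 * parts m (suc n)) (term m (suc n))
                       ⊕ shift (5 + 4 * parts m n) (term m n)
term-recurrence-suc-suc m n = begin
  T
    ≈⟨ split-shift² (2 * suc m) (suc n) T ⟩
  shift (parts (suc m) (suc n)) T ⊕ minusShift (suc n) (shift (2 * suc m) T)
    ⊕ minusShift (2 * suc m) (shift (suc n) T) ⊕ minusShift (2 * suc m) (minusShift (suc n) T)
    ≈⟨ ⊕-congʳ (shift (parts (suc m) (suc n)) T)
         (⊕-cong (shift-term-sucʳ (suc m) n) (⊕-cong (shift-term-sucˡ m (suc n)) (shift-term-suc² m n))) ⟨
  shift (parts (suc m) (suc n)) T ⊕ shift (1 + 2 * parts (suc m) n) (term (suc m) n)
    ⊕ shift (2 + 3 * parts m (suc n)) (term m (suc n)) ⊕ shift (5 + 4 * parts m n) (term m n) ∎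
  where
  open ≗-Reasoning
  T = term (suc m) (suc n)

term-0-0 : term 0 0 ≗ one
term-0-0 k = trans (term≗shift 0 0 k) (sym (inv-unique (one ⊛ one) one refl 1·1·1≗1 k))
  where
  1·1·1≗1 : ((one ⊛ one) ⊛ one) ≗ one
  1·1·1≗1 i = trans (⊛-one (one ⊛ one) i) (one-⊛ one i)

-- Multiplicities and the conditions

private
  variable
    a b c m n x N f : ℕ
    p q r : List ℕ

private
  ≡ᵇ-refl : ∀ x → (x ≡ᵇ x) ≡ true
  ≡ᵇ-refl zero    = refl
  ≡ᵇ-refl (suc x) = ≡ᵇ-refl x

  above⇒≮ : ∀ {y} → All (2 + x ≤_) r → y ∈ r → ¬ (y < x)
  above⇒≮ above y∈r y<x = ℕ.<⇒≱ y<x (ℕ.m+n≤o⇒n≤o 2 (All.lookup above y∈r))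

  +-exchange : ∀ k c x → k + (c + x) ≡ c + (k + x)
  +-exchange = ℕ-Solver.solve-∀

  2+x≰x : ¬ (2 + x ≤ x)
  2+x≰x 2+x≤x = ℕ.1+n≰n (ℕ.m+n≤o⇒n≤o 1 2+x≤x)

  split-≤ : ∀ k {a x} → k + a ≤ x → ∃ λ x' → x ≡ k + x' × a ≤ x'
  split-≤ zero    a≤x         = _ , refl , a≤x
  split-≤ (suc k) (s≤s k+a≤x) with split-≤ k k+a≤x
  ... | x' , refl , a≤x' = x' , refl , a≤x'

occ-here : ∀ x p → occ x (x ∷ p) ≡ suc (occ x p)
occ-here x p rewrite ≡ᵇ-refl x = refl

occ-twice : ∀ x p → occ x (x ∷ x ∷ p) ≡ 2 + occ x p
occ-twice x p = trans (occ-here x (x ∷ p)) (cong suc (occ-here x p))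

2≤occ-twice : ∀ x p → 2 ≤ occ x (x ∷ x ∷ p)
2≤occ-twice x p = subst (2 ≤_) (sym (occ-twice x p)) (ℕ.m≤m+n 2 (occ x p))

occ-there : ∀ {x k} p → x ≢ k → occ k (x ∷ p) ≡ occ k p
occ-there {x} {k} p x≢k with x ≡ᵇ k in eq
... | true  = ⊥-elim (x≢k (ℕ.≡ᵇ⇒≡ x k (subst Bool.T (sym eq) tt)))
... | false = refl

occ-≤-∷ : ∀ k x p → occ k p ≤ occ k (x ∷ p)
occ-≤-∷ k x p with x ≟ k
... | yes refl = subst (occ x p ≤_) (sym (occ-here x p)) (ℕ.n≤1+n _)
... | no x≢k   = ℕ.≤-reflexive (sym (occ-there p x≢k))

occ⇒∈ : ∀ k p → 1 ≤ occ k p → k ∈ p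
occ⇒∈ k (x ∷ p) 1≤occ with x ≟ k
... | yes refl = here refl
... | no x≢k   = there (occ⇒∈ k p (subst (1 ≤_) (occ-there p x≢k) 1≤occ))

∈⇒occ : ∀ {k p} → k ∈ p → 1 ≤ occ k p
∈⇒occ {k} {x ∷ p} (here refl)  = subst (1 ≤_) (sym (occ-here k p)) (s≤s z≤n)
∈⇒occ {k} {x ∷ p} (there k∈p) = ℕ.≤-trans (∈⇒occ k∈p) (occ-≤-∷ k x p)

∉⇒occ≡0 : ∀ k p → ¬ (k ∈ p) → occ k p ≡ 0
∉⇒occ≡0 k []      _   = refl
∉⇒occ≡0 k (x ∷ p) k∉ =
  trans (occ-there p (λ x≡k → k∉ (here (sym x≡k)))) (∉⇒occ≡0 k p (λ k∈p → k∉ (there k∈p)))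

occ-↭ : ∀ k {p p'} → p ↭ p' → occ k p ≡ occ k p'
occ-↭ k ↭.refl = refl
occ-↭ k (↭.prep x p↭p') with x ≡ᵇ k
... | true  = cong suc (occ-↭ k p↭p')
... | false = occ-↭ k p↭p'
occ-↭ k (↭.swap x y p↭p') with x ≡ᵇ k | y ≡ᵇ k
... | true  | true  = cong (2 +_) (occ-↭ k p↭p')
... | true  | false = cong suc (occ-↭ k p↭p')
... | false | true  = cong suc (occ-↭ k p↭p')
... | false | false = occ-↭ k p↭p'
occ-↭ k (↭.trans p↭q q↭p') = trans (occ-↭ k p↭q) (occ-↭ k q↭p')

AtMostTwice GapTwo GapThreeRepeated : List ℕ → Set
AtMostTwice p      = ∀ k → occ k p ≤ 2
GapTwo p           = ∀ a b → a ∈ p → b ∈ p → a < b → 2 + a ≤ b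
GapThreeRepeated p = ∀ a b → 2 ≤ occ a p → 2 ≤ occ b p → a < b → 3 + a ≤ b

Conditions-↭ : p ↭ q → Conditions p → Conditions q
Conditions-↭ p↭q (twice , gap₂ , gap₃) =
  (λ k → subst (_≤ 2) (occ-↭ k p↭q) (twice k)) ,
  (λ a b a∈q b∈q → gap₂ a b (∈-resp-↭ q↭p a∈q) (∈-resp-↭ q↭p b∈q)) ,
  (λ a b 2≤a 2≤b → gap₃ a b (subst (2 ≤_) (occ-↭ a q↭p) 2≤a) (subst (2 ≤_) (occ-↭ b q↭p) 2≤b))
  where q↭p = ↭-sym p↭q

Conditions-tail : Conditions (x ∷ p) → Conditions p
Conditions-tail {x} {p} (twice , gap₂ , gap₃) =
  (λ k → ℕ.≤-trans (occ-≤-∷ k x p) (twice k)) ,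
  (λ a b a∈p b∈p → gap₂ a b (there a∈p) (there b∈p)) ,
  (λ a b 2≤a 2≤b → gap₃ a b (ℕ.≤-trans 2≤a (occ-≤-∷ a x p)) (ℕ.≤-trans 2≤b (occ-≤-∷ b x p)))

GapTwo-∷ : ∀ {x r} p → (∀ y → y ∈ p → y ≡ x ⊎ y ∈ r) → All (2 + x ≤_) r → GapTwo r → GapTwo p
GapTwo-∷ {x} p split above gap₂ a b a∈p b∈p a<b with split a a∈p | split b b∈p
... | inj₁ refl | inj₁ refl = ⊥-elim (ℕ.<-irrefl refl a<b)
... | inj₁ refl | inj₂ b∈r  = All.lookup above b∈r
... | inj₂ a∈r  | inj₁ refl = ⊥-elim (above⇒≮ above a∈r a<b)
... | inj₂ a∈r  | inj₂ b∈r  = gap₂ a b a∈r b∈r a<b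
occ-below : All (2 + x ≤_) r → occ x (x ∷ r) ≡ 1
occ-below {x} {r} above =
  trans (occ-here x r) (cong suc (∉⇒occ≡0 x r λ x∈r → 2+x≰x (All.lookup above x∈r)))

repeated-∷ : ∀ {y} → All (2 + x ≤_) r → 2 ≤ occ y (x ∷ r) → 2 ≤ occ y r
repeated-∷ {x} {r} {y} above 2≤occ with x ≟ y
... | yes refl = ⊥-elim (ℕ.1+n≰n (subst (2 ≤_) (occ-below above) 2≤occ))
... | no x≢y   = subst (2 ≤_) (occ-there r x≢y) 2≤occ

Conditions-single : All (2 + x ≤_) r → Conditions r → Conditions (x ∷ r)
Conditions-single {x} {r} above (twice , gap₂ , gap₃) =
  twice′ , GapTwo-∷ (x ∷ r) split above gap₂ , gap₃′
  where
  split : ∀ y → y ∈ x ∷ r → y ≡ x ⊎ y ∈ r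
  split y (here y≡x) = inj₁ y≡x
  split y (there y∈r) = inj₂ y∈r
  twice′ : AtMostTwice (x ∷ r)
  twice′ k with x ≟ k
  ... | yes refl = ℕ.≤-trans (ℕ.≤-reflexive (occ-below above)) (ℕ.n≤1+n 1)
  ... | no x≢k   = subst (_≤ 2) (sym (occ-there r x≢k)) (twice k)
  gap₃′ : GapThreeRepeated (x ∷ r)
  gap₃′ a b 2≤a 2≤b = gap₃ a b (repeated-∷ above 2≤a) (repeated-∷ above 2≤b)

Conditions-double : All (2 + x ≤_) r → (∀ v → 2 ≤ occ v r → 3 + x ≤ v) → Conditions r →
                    Conditions (x ∷ x ∷ r)
Conditions-double {x} {r} above aboveRepeated (twice , gap₂ , gap₃) =
  twice′ , GapTwo-∷ (x ∷ x ∷ r) split above gap₂ , gap₃′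
  where
  occ-other : ∀ {y} → x ≢ y → occ y (x ∷ x ∷ r) ≡ occ y r
  occ-other x≢y = trans (occ-there (x ∷ r) x≢y) (occ-there r x≢y)
  split : ∀ y → y ∈ x ∷ x ∷ r → y ≡ x ⊎ y ∈ r
  split y (here y≡x)         = inj₁ y≡x
  split y (there (here y≡x)) = inj₁ y≡x
  split y (there (there y∈r)) = inj₂ y∈r
  twice′ : AtMostTwice (x ∷ x ∷ r)
  twice′ k with x ≟ k
  ... | yes refl = ℕ.≤-reflexive (trans (occ-here x (x ∷ r)) (cong suc (occ-below above)))
  ... | no x≢k   = subst (_≤ 2) (sym (occ-other x≢k)) (twice k)
  gap₃′ : GapThreeRepeated (x ∷ x ∷ r)
  gap₃′ a b 2≤a 2≤b a<b with x ≟ a | x ≟ b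
  ... | yes refl | yes refl = ⊥-elim (ℕ.<-irrefl refl a<b)
  ... | yes refl | no x≢b   = aboveRepeated b (subst (2 ≤_) (occ-other x≢b) 2≤b)
  ... | no x≢a   | yes refl =
    ⊥-elim (above⇒≮ above (occ⇒∈ a r (ℕ.≤-trans (ℕ.n≤1+n 1) (subst (2 ≤_) (occ-other x≢a) 2≤a))) a<b)
  ... | no x≢a   | no x≢b   =
    gap₃ a b (subst (2 ≤_) (occ-other x≢a) 2≤a) (subst (2 ≤_) (occ-other x≢b) 2≤b) a<b

-- Admissible partitions

-- Admissible a b m n p: p lists in increasing order a partition satisfying the conditions of the
-- theorem, with m part sizes occurring twice and n occurring once; its first part is ≥ a, and ≥ b if
-- it is repeated.  The gaps 2 and 3 of the conditions reappear in the bounds passed to the tail.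
data Admissible : ℕ → ℕ → ℕ → ℕ → List ℕ → Set where
  []     : Admissible a b 0 0 []
  single : a ≤ x → Admissible (2 + x) (2 + x) m n p → Admissible a b m (suc n) (x ∷ p)
  double : b ≤ x → Admissible (2 + x) (3 + x) m n p → Admissible a b (suc m) n (x ∷ x ∷ p)

Admissible-weaken : ∀ {a' b'} → a' ≤ a → b' ≤ b → Admissible a b m n p → Admissible a' b' m n p
Admissible-weaken a'≤a b'≤b []             = []
Admissible-weaken a'≤a b'≤b (single a≤x adm) = single (ℕ.≤-trans a'≤a a≤x) adm
Admissible-weaken a'≤a b'≤b (double b≤x adm) = double (ℕ.≤-trans b'≤b b≤x) adm

Admissible-cast : ∀ {a' b'} → a ≡ a' → b ≡ b' → Admissible a b m n p → Admissible a' b' m n p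
Admissible-cast refl refl adm = adm

Admissible-rebound : c ≤ x → Admissible a b m n (x ∷ q) → Admissible c c m n (x ∷ q)
Admissible-rebound c≤x (single _ adm) = single c≤x adm
Admissible-rebound c≤x (double _ adm) = double c≤x adm

Admissible-lift : ∀ k → Admissible a b m n p → Admissible (k + a) (k + b) m n (map (k +_) p)
Admissible-lift k []                       = []
Admissible-lift k (single {x = x} a≤x adm) =
  single (ℕ.+-monoʳ-≤ k a≤x)
    (Admissible-cast (+-exchange k 2 x) (+-exchange k 2 x) (Admissible-lift k adm))
Admissible-lift k (double {x = x} b≤x adm) =
  double (ℕ.+-monoʳ-≤ k b≤x)
    (Admissible-cast (+-exchange k 2 x) (+-exchange k 3 x) (Admissible-lift k adm))

Admissible-unlift : ∀ k → Admissible (k + a) (k + b) m n q →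
                    ∃ λ p → q ≡ map (k +_) p × Admissible a b m n p
Admissible-unlift k [] = [] , refl , []
Admissible-unlift k (single k+a≤x adm) with split-≤ k k+a≤x
... | x , refl , a≤x with Admissible-unlift k
      (Admissible-cast (sym (+-exchange k 2 x)) (sym (+-exchange k 2 x)) adm)
...   | p , refl , adm' = x ∷ p , refl , single a≤x adm'
Admissible-unlift k (double k+b≤x adm) with split-≤ k k+b≤x
... | x , refl , b≤x with Admissible-unlift k
      (Admissible-cast (sym (+-exchange k 2 x)) (sym (+-exchange k 3 x)) adm)
...   | p , refl , adm' = x ∷ x ∷ p , refl , double b≤x adm'

Admissible-length : Admissible a b m n p → length p ≡ parts m n
Admissible-length []                           = refl
Admissible-length {m = m} {n = suc n} (single _ adm) =
  trans (cong suc (Admissible-length adm)) (sym (ℕ.+-suc (2 * m) n))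
Admissible-length {m = suc m} {n = n} (double _ adm) =
  trans (cong (2 +_) (Admissible-length adm)) (poly m n)
  where
  poly : ∀ m n → 2 + (2 * m + n) ≡ 2 * suc m + n
  poly = ℕ-Solver.solve-∀

Admissible-head : a ≤ b → Admissible a b m n (x ∷ p) → a ≤ x
Admissible-head a≤b (single a≤x _) = a≤x
Admissible-head a≤b (double b≤x _) = ℕ.≤-trans a≤b b≤x

Admissible-functional : ∀ {a' b' m' n'} → Admissible a b m n p → Admissible a' b' m' n' p →
                        m ≡ m' × n ≡ n'
Admissible-functional []               []               = refl , refl
Admissible-functional (single _ adm)   (single _ adm')  with Admissible-functional adm adm'
... | refl , refl = refl , refl
Admissible-functional (double _ adm)   (double _ adm')  with Admissible-functional adm adm'
... | refl , refl = refl , refl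
Admissible-functional (single _ adm)   (double _ _)     = ⊥-elim (2+x≰x (Admissible-head ℕ.≤-refl adm))
Admissible-functional (double _ _)     (single _ adm')  = ⊥-elim (2+x≰x (Admissible-head ℕ.≤-refl adm'))

record Ascending (a b : ℕ) (q : List ℕ) : Set where
  field
    sorted        : AllPairs _≤_ q
    conditions    : Conditions q
    lower         : All (a ≤_) q
    lowerRepeated : ∀ v → 2 ≤ occ v q → b ≤ v

open Ascending

private
  above-strict : All (x ≤_) r → ¬ (x ∈ r) → All (x <_) r
  above-strict {x} {r} x≤r x∉r = All.tabulate λ {z} z∈r →
    ℕ.≤∧≢⇒< (All.lookup x≤r z∈r) (λ x≡z → x∉r (subst (_∈ r) (sym x≡z) z∈r))

Admissible⇒Ascending : a ≤ b → b ≤ 2 + a → Admissible a b m n q → Ascending a b q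
Admissible⇒Ascending _ _ [] = record
  { sorted = [] ; conditions = (λ _ → z≤n) , (λ _ _ ()) , (λ _ _ ())
  ; lower = [] ; lowerRepeated = λ _ () }
Admissible⇒Ascending {a} {b} a≤b b≤2+a (single {x = x} {p = r} a≤x adm) = record
  { sorted        = All.map (ℕ.≤-trans (ℕ.m≤n+m x 2)) (lower asc) ∷ sorted asc
  ; conditions    = Conditions-single (lower asc) (conditions asc)
  ; lower         = a≤x ∷ All.map (ℕ.≤-trans (ℕ.≤-trans a≤x (ℕ.m≤n+m x 2))) (lower asc)
  ; lowerRepeated = λ v 2≤occ → ℕ.≤-trans b≤2+x (lowerRepeated asc v (repeated-∷ (lower asc) 2≤occ))
  }
  where
  asc = Admissible⇒Ascending ℕ.≤-refl (ℕ.m≤n+m (2 + x) 2) adm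
  b≤2+x = ℕ.≤-trans b≤2+a (ℕ.+-monoʳ-≤ 2 a≤x)
Admissible⇒Ascending {a} {b} a≤b b≤2+a (double {x = x} {p = r} b≤x adm) = record
  { sorted        = (ℕ.≤-refl ∷ x≤r) ∷ (x≤r ∷ sorted asc)
  ; conditions    = Conditions-double (lower asc) (lowerRepeated asc) (conditions asc)
  ; lower         = a≤x ∷ a≤x ∷ All.map (ℕ.≤-trans (ℕ.≤-trans a≤x (ℕ.m≤n+m x 2))) (lower asc)
  ; lowerRepeated = repeated
  }
  where
  asc = Admissible⇒Ascending (ℕ.n≤1+n (2 + x)) (ℕ.n≤1+n (3 + x)) adm
  a≤x = ℕ.≤-trans a≤b b≤x
  x≤r = All.map (ℕ.≤-trans (ℕ.m≤n+m x 2)) (lower asc)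
  repeated : ∀ v → 2 ≤ occ v (x ∷ x ∷ r) → b ≤ v
  repeated v 2≤occ with x ≟ v
  ... | yes refl = b≤x
  ... | no x≢v   = ℕ.≤-trans b≤x (ℕ.≤-trans (ℕ.m≤n+m x 3) (lowerRepeated asc v
                     (subst (2 ≤_) (trans (occ-there (x ∷ r) x≢v) (occ-there r x≢v)) 2≤occ)))

head-∉ : ∀ {y} → x ≢ y → AllPairs _≤_ (x ∷ y ∷ r) → ¬ (x ∈ y ∷ r)
head-∉ x≢y _                              (here x≡y)  = x≢y x≡y
head-∉ x≢y ((x≤y ∷ _) ∷ (y≤r ∷ _)) (there x∈r) = x≢y (ℕ.≤-antisym x≤y (All.lookup y≤r x∈r))

Ascending-drop-single : ¬ (x ∈ r) → Ascending a b (x ∷ r) → Ascending (2 + x) (2 + x) r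
Ascending-drop-single {x} {r} x∉r asc = record
  { sorted        = AllPairs.tail (sorted asc)
  ; conditions    = Conditions-tail (conditions asc)
  ; lower         = above
  ; lowerRepeated = λ v 2≤occ → All.lookup above (occ⇒∈ v r (ℕ.≤-trans (ℕ.n≤1+n 1) 2≤occ))
  }
  where
  x<r = above-strict (AllPairs.head (sorted asc)) x∉r
  above : All (2 + x ≤_) r
  above = All.tabulate λ {z} z∈r →
    proj₁ (proj₂ (conditions asc)) x z (here refl) (there z∈r) (All.lookup x<r z∈r)

Ascending-drop-double : Ascending a b (x ∷ x ∷ r) → Ascending (2 + x) (3 + x) r
Ascending-drop-double {a} {b} {x} {r} asc = record
  { sorted        = AllPairs.tail (AllPairs.tail (sorted asc))
  ; conditions    = Conditions-tail (Conditions-tail (conditions asc))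
  ; lower         = above
  ; lowerRepeated = λ v 2≤occ → proj₂ (proj₂ (conditions asc)) x v (2≤occ-twice x r)
                      (ℕ.≤-trans 2≤occ (ℕ.≤-trans (occ-≤-∷ v x r) (occ-≤-∷ v x (x ∷ r))))
                      (All.lookup x<r (occ⇒∈ v r (ℕ.≤-trans (ℕ.n≤1+n 1) 2≤occ)))
  }
  where
  x∉r : ¬ (x ∈ r)
  x∉r x∈r = ℕ.1+n≰n (ℕ.≤-trans (ℕ.+-monoʳ-≤ 2 (∈⇒occ x∈r))
              (subst (_≤ 2) (occ-twice x r) (proj₁ (conditions asc) x)))
  x<r = above-strict (All.tail (AllPairs.head (sorted asc))) x∉r
  above : All (2 + x ≤_) r
  above = All.tabulate λ {z} z∈r →
    proj₁ (proj₂ (conditions asc)) x z (here refl) (there (there z∈r)) (All.lookup x<r z∈r)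

Ascending⇒Admissible : ∀ q → Ascending a b q → ∃₂ λ m n → Admissible a b m n q
Ascending∷⇒Admissible : ∀ x r → Ascending a b (x ∷ r) → ∃₂ λ m n → Admissible a b m n (x ∷ r)

Ascending⇒Admissible []      _   = 0 , 0 , []
Ascending⇒Admissible (x ∷ r) asc = Ascending∷⇒Admissible x r asc

Ascending∷⇒Admissible x []      asc = 0 , 1 , single (All.head (lower asc)) []
Ascending∷⇒Admissible x (y ∷ r) asc with x ≟ y
... | yes refl =
  let m , n , adm = Ascending⇒Admissible r (Ascending-drop-double asc)
  in  suc m , n , double (lowerRepeated asc x (2≤occ-twice x r)) adm
... | no x≢y   =
  let m , n , adm = Ascending∷⇒Admissible y r (Ascending-drop-single (head-∉ x≢y (sorted asc)) asc)
  in  m , suc n , single (All.head (lower asc)) adm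

-- Enumeration

shiftList : ∀ {A : Set} → ℕ → (ℕ → List A) → ℕ → List A
shiftList zero    xs N       = xs N
shiftList (suc s) xs zero    = []
shiftList (suc s) xs (suc N) = shiftList s xs N

module _ {A : Set} {xs : ℕ → List A} where

  length-shiftList : ∀ s {t : PS} N → (∀ N' → s + N' ≡ N → ℤ.+ length (xs N') ≡ t N') →
                     ℤ.+ length (shiftList s xs N) ≡ shift s t N
  length-shiftList zero    N       lengths = lengths N refl
  length-shiftList (suc s) zero    lengths = refl
  length-shiftList (suc s) (suc N) lengths = length-shiftList s N (λ N' eq → lengths N' (cong suc eq))

  ∈-shiftList⁻ : ∀ s {N y} → y ∈ shiftList s xs N → ∃ λ N' → N ≡ s + N' × y ∈ xs N'
  ∈-shiftList⁻ zero    {N}     y∈ = N , refl , y∈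
  ∈-shiftList⁻ (suc s) {suc N} y∈ with ∈-shiftList⁻ s y∈
  ... | N' , refl , y∈xs = N' , refl , y∈xs

  ∈-shiftList⁺ : ∀ s {N y} → y ∈ xs N → y ∈ shiftList s xs (s + N)
  ∈-shiftList⁺ zero    y∈ = y∈
  ∈-shiftList⁺ (suc s) y∈ = ∈-shiftList⁺ s y∈

  shiftList-unique : ∀ s N → (∀ N → Unique (xs N)) → Unique (shiftList s xs N)
  shiftList-unique zero    N       unique = unique N
  shiftList-unique (suc s) zero    unique = []
  shiftList-unique (suc s) (suc N) unique = shiftList-unique s N unique

data Branch : Set where
  noOne singleOne doubleOne doubleOneThree : Branch

prefix : Branch → List ℕ
prefix noOne          = []
prefix singleOne      = 1 ∷ []
prefix doubleOne      = 1 ∷ 1 ∷ []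
prefix doubleOneThree = 1 ∷ 1 ∷ 3 ∷ []

embed : Branch → List ℕ → List ℕ
embed b p = prefix b ++ map (suc (length (prefix b)) +_) p

weight : Branch → ℕ → ℕ
weight noOne          c = c
weight singleOne      c = 1 + 2 * c
weight doubleOne      c = 2 + 3 * c
weight doubleOneThree c = 5 + 4 * c

sum-map-+ : ∀ k p → sum (map (k +_) p) ≡ k * length p + sum p
sum-map-+ k []      = sym (cong (_+ 0) (ℕ.*-zeroʳ k))
sum-map-+ k (x ∷ p) = trans (cong (k + x +_) (sum-map-+ k p)) (poly k x (length p) (sum p))
  where
  poly : ∀ k x l s → k + x + (k * l + s) ≡ k * suc l + (x + s)
  poly = ℕ-Solver.solve-∀

sum-embed : ∀ b p → sum (embed b p) ≡ weight b (length p) + sum p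
sum-embed b p = begin
  sum (prefix b ++ map (k +_) p)            ≡⟨ sum-++ (prefix b) _ ⟩
  sum (prefix b) + sum (map (k +_) p)       ≡⟨ cong (sum (prefix b) +_) (sum-map-+ k p) ⟩
  sum (prefix b) + (k * length p + sum p)   ≡⟨ regroup b (length p) (sum p) ⟩
  weight b (length p) + sum p               ∎
  where
  open ≡-Reasoning
  k = suc (length (prefix b))
  regroup : ∀ b c s → sum (prefix b) + (suc (length (prefix b)) * c + s) ≡ weight b c + s
  regroup noOne          c s = cong (_+ s) (ℕ.*-identityˡ c)
  regroup singleOne      c s = sym (ℕ.+-assoc 1 (2 * c) s)
  regroup doubleOne      c s = sym (ℕ.+-assoc 2 (3 * c) s)
  regroup doubleOneThree c s = sym (ℕ.+-assoc 5 (4 * c) s)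

embed-injective : ∀ b {p p'} → embed b p ≡ embed b p' → p ≡ p'
embed-injective b eq =
  List.map-injective (ℕ.+-cancelˡ-≡ (suc (length (prefix b))) _ _) (List.++-cancelˡ (prefix b) _ _ eq)

Admissible-embed-noOne : Admissible 1 1 m n p → Admissible 1 1 m n (embed noOne p)
Admissible-embed-noOne adm = Admissible-weaken (s≤s z≤n) (s≤s z≤n) (Admissible-lift 1 adm)

Admissible-embed-singleOne : Admissible 1 1 m n p → Admissible 1 1 m (suc n) (embed singleOne p)
Admissible-embed-singleOne adm = single ℕ.≤-refl (Admissible-lift 2 adm)

Admissible-embed-doubleOne : Admissible 1 1 m n p → Admissible 1 1 (suc m) n (embed doubleOne p)
Admissible-embed-doubleOne adm =
  double ℕ.≤-refl (Admissible-weaken (ℕ.n≤1+n 3) ℕ.≤-refl (Admissible-lift 3 adm))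

Admissible-embed-doubleOneThree : Admissible 1 1 m n p → Admissible 1 1 (suc m) (suc n) (embed doubleOneThree p)
Admissible-embed-doubleOneThree adm = double ℕ.≤-refl (single ℕ.≤-refl (Admissible-lift 4 adm))

branch : Branch → ℕ → ℕ → (ℕ → ℕ → ℕ → List (List ℕ)) → ℕ → List (List ℕ)
branch b m n xs = shiftList (weight b (parts m n)) (λ N → map (embed b) (xs m n N))

-- f is fuel for the recursion on N: the list is complete only for N < f
admissibles : ℕ → ℕ → ℕ → ℕ → List (List ℕ)
admissibles zero    _       _       _       = []
admissibles (suc f) zero    zero    zero    = [] ∷ []
admissibles (suc f) zero    zero    (suc N) = []
admissibles (suc f) zero    (suc n) N =
     branch noOne          zero    (suc n) (admissibles f) N
  ++ branch singleOne      zero    n       (admissibles f) N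
admissibles (suc f) (suc m) zero    N =
     branch noOne          (suc m) zero    (admissibles f) N
  ++ branch doubleOne      m       zero    (admissibles f) N
admissibles (suc f) (suc m) (suc n) N =
     branch noOne          (suc m) (suc n) (admissibles f) N
  ++ branch singleOne      (suc m) n       (admissibles f) N
  ++ branch doubleOne      m       (suc n) (admissibles f) N
  ++ branch doubleOneThree m       n       (admissibles f) N

private
  fuel-bound : ∀ {w k} → 1 ≤ w → w + k < suc f → k < f
  fuel-bound {w = w} {k} 1≤w w+k<1+f = ℕ.<-≤-trans (ℕ.m<n+m k 1≤w) (ℕ.≤-pred w+k<1+f)

length-admissibles : ∀ f m n N → N < f → ℤ.+ length (admissibles f m n N) ≡ term m n N
length-branch : ∀ f b m n → 1 ≤ weight b (parts m n) → N < suc f →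
  ℤ.+ length (branch b m n (admissibles f) N) ≡ shift (weight b (parts m n)) (term m n) N

length-branch {N} f b m n 1≤w N<1+f =
  length-shiftList (weight b (parts m n)) N λ N' w+N'≡N →
    trans (cong ℤ.+_ (List.length-map (embed b) (admissibles f m n N')))
          (length-admissibles f m n N' (fuel-bound 1≤w (subst (_< suc f) (sym w+N'≡N) N<1+f)))

length-branch-++ : ∀ f b m n {ys : List (List ℕ)} {v} → 1 ≤ weight b (parts m n) → N < suc f →
  ℤ.+ length ys ≡ v →
  ℤ.+ length (branch b m n (admissibles f) N ++ ys) ≡ shift (weight b (parts m n)) (term m n) N ℤ.+ v
length-branch-++ f b m n {ys} 1≤w N<1+f refl =
  trans (cong ℤ.+_ (List.length-++ B)) (trans (ℤ.pos-+ (length B) (length ys))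
        (cong (ℤ._+ ℤ.+ length ys) (length-branch f b m n 1≤w N<1+f)))
  where B = branch b m n (admissibles f) _

length-admissibles (suc f) zero    zero    zero    _ = sym (term-0-0 0)
length-admissibles (suc f) zero    zero    (suc N) _ = sym (term-0-0 (suc N))
length-admissibles (suc f) zero    (suc n) N N<1+f =
  trans (length-branch-++ f noOne 0 (suc n) (s≤s z≤n) N<1+f
          (length-branch f singleOne 0 n (s≤s z≤n) N<1+f))
        (sym (term-recurrence-0-suc n N))
length-admissibles (suc f) (suc m) zero    N N<1+f =
  trans (length-branch-++ f noOne (suc m) 0 (s≤s z≤n) N<1+f
          (length-branch f doubleOne m 0 (s≤s z≤n) N<1+f))
        (sym (term-recurrence-suc-0 m N))
length-admissibles (suc f) (suc m) (suc n) N N<1+f =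
  trans (length-branch-++ f noOne (suc m) (suc n) (s≤s z≤n) N<1+f
          (length-branch-++ f singleOne (suc m) n (s≤s z≤n) N<1+f
          (length-branch-++ f doubleOne m (suc n) (s≤s z≤n) N<1+f
          (length-branch f doubleOneThree m n (s≤s z≤n) N<1+f))))
        (sym (term-recurrence-suc-suc m n N))

sum-embed-Admissible : ∀ b → Admissible a c m n p → sum (embed b p) ≡ weight b (parts m n) + sum p
sum-embed-Admissible {p = p} b adm =
  trans (sum-embed b p) (cong (λ k → weight b k + sum p) (Admissible-length adm))

∈-branch⁻ : ∀ b m n xs → q ∈ branch b m n xs N →
            ∃₂ λ p N' → q ≡ embed b p × N ≡ weight b (parts m n) + N' × p ∈ xs m n N'
∈-branch⁻ b m n xs q∈ with ∈-shiftList⁻ (weight b (parts m n)) q∈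
... | N' , N≡w+N' , q∈map with ∈-map⁻ (embed b) q∈map
... | p , p∈ , q≡embed = p , N' , q≡embed , N≡w+N' , p∈

admissibles-sound : ∀ f m n N → q ∈ admissibles f m n N → Admissible 1 1 m n q × sum q ≡ N
branch-sound : ∀ f b m n {m' n'} → (∀ {p} → Admissible 1 1 m n p → Admissible 1 1 m' n' (embed b p)) →
               q ∈ branch b m n (admissibles f) N → Admissible 1 1 m' n' q × sum q ≡ N

branch-sound f b m n embed-Admissible q∈ with ∈-branch⁻ b m n (admissibles f) q∈
... | p , N' , refl , refl , p∈ with admissibles-sound f m n N' p∈
... | adm , refl = embed-Admissible adm , sum-embed-Admissible b adm

admissibles-sound (suc f) zero    zero    zero    (here refl) = [] , refl
admissibles-sound (suc f) zero    (suc n) N q∈ with ∈-++⁻ (branch noOne 0 (suc n) (admissibles f) N) q∈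
... | inj₁ q∈₁ = branch-sound f noOne 0 (suc n) Admissible-embed-noOne q∈₁
... | inj₂ q∈₂ = branch-sound f singleOne 0 n Admissible-embed-singleOne q∈₂
admissibles-sound (suc f) (suc m) zero    N q∈ with ∈-++⁻ (branch noOne (suc m) 0 (admissibles f) N) q∈
... | inj₁ q∈₁ = branch-sound f noOne (suc m) 0 Admissible-embed-noOne q∈₁
... | inj₂ q∈₂ = branch-sound f doubleOne m 0 Admissible-embed-doubleOne q∈₂
admissibles-sound (suc f) (suc m) (suc n) N q∈ with ∈-++⁻ (branch noOne (suc m) (suc n) (admissibles f) N) q∈
... | inj₁ q∈₁ = branch-sound f noOne (suc m) (suc n) Admissible-embed-noOne q∈₁
... | inj₂ q∈₂ with ∈-++⁻ (branch singleOne (suc m) n (admissibles f) N) q∈₂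
...   | inj₁ q∈₃ = branch-sound f singleOne (suc m) n Admissible-embed-singleOne q∈₃
...   | inj₂ q∈₄ with ∈-++⁻ (branch doubleOne m (suc n) (admissibles f) N) q∈₄
...     | inj₁ q∈₅ = branch-sound f doubleOne m (suc n) Admissible-embed-doubleOne q∈₅
...     | inj₂ q∈₆ = branch-sound f doubleOneThree m n Admissible-embed-doubleOneThree q∈₆

branchOf : List ℕ → Branch
branchOf (1 ∷ 1 ∷ 3 ∷ _) = doubleOneThree
branchOf (1 ∷ 1 ∷ _)     = doubleOne
branchOf (1 ∷ _)         = singleOne
branchOf _               = noOne

branchOf-embed : ∀ b → All (1 ≤_) p → branchOf (embed b p) ≡ b
branchOf-embed noOne          []          = refl
branchOf-embed noOne          (s≤s _ ∷ _) = refl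
branchOf-embed singleOne      []          = refl
branchOf-embed singleOne      (_ ∷ _)     = refl
branchOf-embed doubleOne      []          = refl
branchOf-embed doubleOne      (s≤s _ ∷ _) = refl
branchOf-embed doubleOneThree _           = refl

rank : Branch → ℕ
rank b = length (prefix b)

Keyed UniqueFrom : Branch → List (List ℕ) → Set
Keyed      b xs = Unique xs × All (λ q → branchOf q ≡ b) xs
UniqueFrom b xs = Unique xs × All (λ q → rank b ≤ rank (branchOf q)) xs

Keyed⇒UniqueFrom : ∀ {b xs} → Keyed b xs → UniqueFrom b xs
Keyed⇒UniqueFrom (unique , keys) =
  unique , All.map (λ key≡b → ℕ.≤-reflexive (cong rank (sym key≡b))) keys

++-UniqueFrom : ∀ {b} b' {xs ys} → rank b < rank b' → Keyed b xs → UniqueFrom b' ys →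
                UniqueFrom b (xs ++ ys)
++-UniqueFrom {b} b' b<b' (uxs , keys) (uys , ranks) =
  Unique.++⁺ uxs uys (λ (v∈xs , v∈ys) → ℕ.<⇒≱ b<b'
    (subst (λ b'' → rank b' ≤ rank b'') (All.lookup keys v∈xs) (All.lookup ranks v∈ys))) ,
  Allₚ.++⁺ (proj₂ (Keyed⇒UniqueFrom (uxs , keys))) (All.map (ℕ.≤-trans (ℕ.<⇒≤ b<b')) ranks)

admissibles-unique : ∀ f m n N → Unique (admissibles f m n N)
branch-Keyed : ∀ f b m n N → Keyed b (branch b m n (admissibles f) N)

branch-Keyed f b m n N =
  shiftList-unique (weight b (parts m n)) N
    (λ N' → Unique.map⁺ (embed-injective b) (admissibles-unique f m n N')) ,
  All.tabulate key
  where
  key : q ∈ branch b m n (admissibles f) N → branchOf q ≡ b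
  key q∈ with ∈-branch⁻ b m n (admissibles f) q∈
  ... | p , N' , refl , _ , p∈ =
    branchOf-embed b
      (lower (Admissible⇒Ascending ℕ.≤-refl (s≤s z≤n) (proj₁ (admissibles-sound f m n N' p∈))))

admissibles-unique zero    _       _       _       = []
admissibles-unique (suc f) zero    zero    zero    = [] ∷ []
admissibles-unique (suc f) zero    zero    (suc N) = []
admissibles-unique (suc f) zero    (suc n) N = proj₁
  (++-UniqueFrom singleOne (s≤s z≤n) (branch-Keyed f noOne 0 (suc n) N)
  (Keyed⇒UniqueFrom (branch-Keyed f singleOne 0 n N)))
admissibles-unique (suc f) (suc m) zero    N = proj₁
  (++-UniqueFrom doubleOne (s≤s z≤n) (branch-Keyed f noOne (suc m) 0 N)
  (Keyed⇒UniqueFrom (branch-Keyed f doubleOne m 0 N)))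
admissibles-unique (suc f) (suc m) (suc n) N = proj₁
  (++-UniqueFrom singleOne      (s≤s z≤n)   (branch-Keyed f noOne (suc m) (suc n) N)
  (++-UniqueFrom doubleOne      (ℕ.n<1+n 1) (branch-Keyed f singleOne (suc m) n N)
  (++-UniqueFrom doubleOneThree (ℕ.n<1+n 2) (branch-Keyed f doubleOne m (suc n) N)
  (Keyed⇒UniqueFrom (branch-Keyed f doubleOneThree m n N)))))

data Peeled : ℕ → ℕ → List ℕ → Set where
  noOne          : Admissible 1 1 m n p → Peeled m n (embed noOne p)
  singleOne      : Admissible 1 1 m n p → Peeled m (suc n) (embed singleOne p)
  doubleOne      : Admissible 1 1 m n p → Peeled (suc m) n (embed doubleOne p)
  doubleOneThree : Admissible 1 1 m n p → Peeled (suc m) (suc n) (embed doubleOneThree p)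

private
  peel-noOne : Admissible 2 2 m n q → Peeled m n q
  peel-noOne adm with Admissible-unlift 1 adm
  ... | p , refl , adm' = noOne adm'

  peel-doubleOne : Admissible 4 4 m n r → Peeled (suc m) n (1 ∷ 1 ∷ r)
  peel-doubleOne adm with Admissible-unlift 3 adm
  ... | p , refl , adm' = doubleOne adm'

peel : Admissible 1 1 m n q → Peeled m n q
peel []                                     = noOne []
peel (single {x = zero} () _)
peel (double {x = zero} () _)
peel adm@(single {x = suc (suc _)} _ _)     = peel-noOne (Admissible-rebound (s≤s (s≤s z≤n)) adm)
peel adm@(double {x = suc (suc _)} _ _)     = peel-noOne (Admissible-rebound (s≤s (s≤s z≤n)) adm)
peel (single {x = 1} _ adm) with Admissible-unlift 2 adm
... | p , refl , adm' = singleOne adm'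
peel (double {x = 1} _ [])                  = doubleOne []
peel (double {x = 1} _ (single {x = 3} _ adm)) with Admissible-unlift 4 adm
... | p , refl , adm' = doubleOneThree adm'
peel (double {x = 1} _ adm@(single {x = suc (suc (suc (suc _)))} _ _)) =
  peel-doubleOne (Admissible-rebound (s≤s (s≤s (s≤s (s≤s z≤n)))) adm)
peel (double {x = 1} _ adm@(double {x = suc (suc (suc (suc _)))} _ _)) =
  peel-doubleOne (Admissible-rebound (s≤s (s≤s (s≤s (s≤s z≤n)))) adm)
peel (double {x = 1} _ (single {x = 0} () _))
peel (double {x = 1} _ (single {x = 1} (s≤s ()) _))
peel (double {x = 1} _ (single {x = 2} (s≤s (s≤s ())) _))
peel (double {x = 1} _ (double {x = 0} () _))
peel (double {x = 1} _ (double {x = 1} (s≤s ()) _))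
peel (double {x = 1} _ (double {x = 2} (s≤s (s≤s ())) _))
peel (double {x = 1} _ (double {x = 3} (s≤s (s≤s (s≤s ()))) _))

admissibles-complete : ∀ f → Admissible 1 1 m n q → sum q ≡ N → N < f → q ∈ admissibles f m n N
∈-branch : ∀ f b → Admissible 1 1 m n p → sum (embed b p) ≡ N → 1 ≤ weight b (parts m n) → N < suc f →
           embed b p ∈ branch b m n (admissibles f) N

∈-branch {m} {n} {p} f b adm refl 1≤w N<1+f =
  subst (λ N → embed b p ∈ branch b m n (admissibles f) N) (sym sum≡)
    (∈-shiftList⁺ (weight b (parts m n)) (∈-map⁺ (embed b)
      (admissibles-complete f adm refl (fuel-bound 1≤w (subst (_< suc f) sum≡ N<1+f)))))
  where sum≡ = sum-embed-Admissible b adm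

admissibles-complete {N = N} (suc f) adm sum≡N N<1+f = complete (peel adm) sum≡N
  where
  B : Branch → ℕ → ℕ → List (List ℕ)
  B b m n = branch b m n (admissibles f) N
  ∈-B : ∀ b → Admissible 1 1 m n p → sum (embed b p) ≡ N → 1 ≤ weight b (parts m n) →
        embed b p ∈ B b m n
  ∈-B b adm sum≡N 1≤w = ∈-branch f b adm sum≡N 1≤w N<1+f
  complete : Peeled m n q → sum q ≡ N → q ∈ admissibles (suc f) m n N
  complete (noOne {m = zero}  {n = zero}  []) refl = here refl
  complete (noOne {m = zero}  {n = suc n} adm) eq = ∈-++⁺ˡ (∈-B noOne adm eq (s≤s z≤n))
  complete (noOne {m = suc m} {n = zero}  adm) eq = ∈-++⁺ˡ (∈-B noOne adm eq (s≤s z≤n))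
  complete (noOne {m = suc m} {n = suc n} adm) eq = ∈-++⁺ˡ (∈-B noOne adm eq (s≤s z≤n))
  complete (singleOne {m = zero}  {n} adm) eq =
    ∈-++⁺ʳ (B noOne 0 (suc n)) (∈-B singleOne adm eq (s≤s z≤n))
  complete (singleOne {m = suc m} {n} adm) eq =
    ∈-++⁺ʳ (B noOne (suc m) (suc n)) (∈-++⁺ˡ (∈-B singleOne adm eq (s≤s z≤n)))
  complete (doubleOne {m} {n = zero}  adm) eq =
    ∈-++⁺ʳ (B noOne (suc m) 0) (∈-B doubleOne adm eq (s≤s z≤n))
  complete (doubleOne {m} {n = suc n} adm) eq =
    ∈-++⁺ʳ (B noOne (suc m) (suc n)) (∈-++⁺ʳ (B singleOne (suc m) n)
      (∈-++⁺ˡ (∈-B doubleOne adm eq (s≤s z≤n))))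
  complete (doubleOneThree {m} {n} adm) eq =
    ∈-++⁺ʳ (B noOne (suc m) (suc n)) (∈-++⁺ʳ (B singleOne (suc m) n) (∈-++⁺ʳ (B doubleOne m (suc n))
      (∈-B doubleOneThree adm eq (s≤s z≤n))))

-- Summing over m and n

concatTo : ∀ {A : Set} → ℕ → (ℕ → List A) → List A
concatTo zero    xs = xs 0
concatTo (suc n) xs = concatTo n xs ++ xs (suc n)

module _ {A : Set} {xs : ℕ → List A} where

  length-concatTo : ∀ n → ℤ.+ length (concatTo n xs) ≡ sumTo n (λ k → ℤ.+ length (xs k))
  length-concatTo zero    = refl
  length-concatTo (suc n) = begin
    ℤ.+ length (concatTo n xs ++ xs (suc n))                 ≡⟨ cong ℤ.+_ (List.length-++ (concatTo n xs)) ⟩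
    ℤ.+ (length (concatTo n xs) + length (xs (suc n)))       ≡⟨ ℤ.pos-+ (length (concatTo n xs)) _ ⟩
    ℤ.+ length (concatTo n xs) ℤ.+ ℤ.+ length (xs (suc n))
      ≡⟨ cong (ℤ._+ ℤ.+ length (xs (suc n))) (length-concatTo n) ⟩
    sumTo (suc n) (λ k → ℤ.+ length (xs k))                  ∎
    where open ≡-Reasoning

  ∈-concatTo⁻ : ∀ n {y} → y ∈ concatTo n xs → ∃ λ k → k ≤ n × y ∈ xs k
  ∈-concatTo⁻ zero    y∈ = 0 , z≤n , y∈
  ∈-concatTo⁻ (suc n) y∈ with ∈-++⁻ (concatTo n xs) y∈
  ... | inj₂ y∈xs = suc n , ℕ.≤-refl , y∈xs
  ... | inj₁ y∈concat with ∈-concatTo⁻ n y∈concat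
  ...   | k , k≤n , y∈xs = k , ℕ.m≤n⇒m≤1+n k≤n , y∈xs

  ∈-concatTo⁺ : ∀ n {k y} → k ≤ n → y ∈ xs k → y ∈ concatTo n xs
  ∈-concatTo⁺ zero    z≤n y∈ = y∈
  ∈-concatTo⁺ (suc n) k≤1+n y∈ with ℕ.m≤n⇒m<n∨m≡n k≤1+n
  ... | inj₁ k<1+n = ∈-++⁺ˡ (∈-concatTo⁺ n (ℕ.≤-pred k<1+n) y∈)
  ... | inj₂ refl  = ∈-++⁺ʳ (concatTo n xs) y∈

  concatTo-unique : (R : ℕ → A → Set) → (∀ {i j y} → R i y → R j y → i ≡ j) →
                    (∀ k → Unique (xs k)) → (∀ k {y} → y ∈ xs k → R k y) →
                    ∀ n → Unique (concatTo n xs)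
  concatTo-unique R functional unique R-xs zero    = unique 0
  concatTo-unique R functional unique R-xs (suc n) =
    Unique.++⁺ (concatTo-unique R functional unique R-xs n) (unique (suc n)) λ (y∈concat , y∈xs) →
      let k , k≤n , y∈xsₖ = ∈-concatTo⁻ n y∈concat
      in  ℕ.1+n≰n (subst (_≤ n) (functional (R-xs k y∈xsₖ) (R-xs (suc n) y∈xs)) k≤n)

-- the summand of `rhsCoeff M N` indexed by m and n, as a list of partitions
admissiblesOfSize : ℕ → ℕ → ℕ → ℕ → List (List ℕ)
admissiblesOfSize M N m n = if parts m n ≡ᵇ M then admissibles (suc N) m n N else []

ascendingPartitions : ℕ → ℕ → List (List ℕ)
ascendingPartitions M N = concatTo M (λ m → concatTo M (admissiblesOfSize M N m))

length-admissiblesOfSize : ∀ M N m n →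
  ℤ.+ length (admissiblesOfSize M N m n) ≡ (if parts m n ≡ᵇ M then term m n N else 0ℤ)
length-admissiblesOfSize M N m n with parts m n ≡ᵇ M
... | true  = length-admissibles (suc N) m n N (ℕ.n<1+n N)
... | false = refl

∈-admissiblesOfSize⁻ : ∀ M N m n → q ∈ admissiblesOfSize M N m n →
                       parts m n ≡ M × Admissible 1 1 m n q × sum q ≡ N
∈-admissiblesOfSize⁻ M N m n q∈ with parts m n ≡ᵇ M in eq
... | true = ℕ.≡ᵇ⇒≡ (parts m n) M (subst Bool.T (sym eq) tt) , admissibles-sound (suc N) m n N q∈

∈-admissiblesOfSize⁺ : ∀ {M} N → parts m n ≡ M → Admissible 1 1 m n q → sum q ≡ N →
                       q ∈ admissiblesOfSize M N m n
∈-admissiblesOfSize⁺ {m} {n} {M = M} N parts≡M adm sum≡N with parts m n ≡ᵇ M in eq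
... | true  = admissibles-complete (suc N) adm sum≡N (ℕ.n<1+n N)
... | false = ⊥-elim (subst Bool.T eq (ℕ.≡⇒≡ᵇ (parts m n) M parts≡M))

length-ascendingPartitions : ∀ M N → ℤ.+ length (ascendingPartitions M N) ≡ rhsCoeff M N
length-ascendingPartitions M N =
  trans (length-concatTo M) (sumTo-cong M λ m _ →
  trans (length-concatTo M) (sumTo-cong M λ n _ → length-admissiblesOfSize M N m n))

ascendingPartitions-unique : ∀ M N → Unique (ascendingPartitions M N)
ascendingPartitions-unique M N =
  concatTo-unique (λ m q → ∃ λ n → Admissible 1 1 m n q)
    (λ (_ , adm) (_ , adm') → proj₁ (Admissible-functional adm adm'))
    (λ m → concatTo-unique (λ n → Admissible 1 1 m n)
             (λ adm adm' → proj₂ (Admissible-functional adm adm'))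
             (λ n → unique m n) (λ n q∈ → admissible q∈) M)
    (λ m q∈ → let n , _ , q∈ₙ = ∈-concatTo⁻ M q∈ in n , admissible q∈ₙ) M
  where
  unique : ∀ m n → Unique (admissiblesOfSize M N m n)
  unique m n with parts m n ≡ᵇ M
  ... | true  = admissibles-unique (suc N) m n N
  ... | false = []
  admissible : ∀ {m n} → q ∈ admissiblesOfSize M N m n → Admissible 1 1 m n q
  admissible {m = m} {n} q∈ = proj₁ (proj₂ (∈-admissiblesOfSize⁻ M N m n q∈))

∈-ascendingPartitions⁻ : ∀ M N → q ∈ ascendingPartitions M N →
                         ∃₂ λ m n → parts m n ≡ M × Admissible 1 1 m n q × sum q ≡ N
∈-ascendingPartitions⁻ M N q∈ =
  let m , _ , q∈ₘ = ∈-concatTo⁻ M q∈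
      n , _ , q∈ₘₙ = ∈-concatTo⁻ M q∈ₘ
  in  m , n , ∈-admissiblesOfSize⁻ M N m n q∈ₘₙ

∈-ascendingPartitions⁺ : ∀ {M} N → parts m n ≡ M → Admissible 1 1 m n q → sum q ≡ N →
                         q ∈ ascendingPartitions M N
∈-ascendingPartitions⁺ {m} {n} N refl adm sum≡N =
  ∈-concatTo⁺ (parts m n) (ℕ.≤-trans (ℕ.m≤m+n m (m + 0)) (ℕ.m≤m+n (2 * m) n))
    (∈-concatTo⁺ (parts m n) (ℕ.m≤n+m n (2 * m)) (∈-admissiblesOfSize⁺ N refl adm sum≡N))

AllPairs-reverse : ∀ {A : Set} {R : A → A → Set} {xs} → AllPairs R xs → AllPairs (flip R) (reverse xs)
AllPairs-reverse []                          = []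
AllPairs-reverse {R = R} {x ∷ xs} (Rx ∷ Rxs) =
  subst (AllPairs (flip R)) (sym (List.unfold-reverse x xs))
    (AllPairsₚ.++⁺ (AllPairs-reverse Rxs) ([] ∷ [])
      (All.tabulate λ y∈ → All.lookup Rx (∈-resp-↭ (↭-reverse xs) y∈) ∷ []))

Admissible⇒IsPartitionOf : ∀ {M} → Admissible 1 1 m n q → parts m n ≡ M → sum q ≡ N →
  IsPartitionOf N (reverse q) × length (reverse q) ≡ M × Conditions (reverse q)
Admissible⇒IsPartitionOf {q = q} adm parts≡M sum≡N =
  (All-resp-↭ q↭rev (lower asc) ,
   AllPairs⇒Linked (AllPairs-reverse (sorted asc)) ,
   trans (sum-↭ (↭-reverse q)) sum≡N) ,
  trans (List.length-reverse q) (trans (Admissible-length adm) parts≡M) ,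
  Conditions-↭ q↭rev (conditions asc)
  where
  asc = Admissible⇒Ascending ℕ.≤-refl (s≤s z≤n) adm
  q↭rev = ↭-sym (↭-reverse q)

IsPartitionOf⇒Admissible : ∀ {M} → IsPartitionOf N p × length p ≡ M × Conditions p →
  ∃₂ λ m n → parts m n ≡ M × Admissible 1 1 m n (reverse p) × sum (reverse p) ≡ N
IsPartitionOf⇒Admissible {p = p} ((positive , decreasing , sum≡N) , length≡M , conditions) =
  let m , n , adm = Ascending⇒Admissible (reverse p) asc
  in  m , n , trans (sym (Admissible-length adm)) (trans (List.length-reverse p) length≡M) , adm ,
      trans (sum-↭ (↭-reverse p)) sum≡N
  where
  p↭rev = ↭-sym (↭-reverse p)
  asc : Ascending 1 1 (reverse p)
  asc = record
    { sorted        = AllPairs-reverse (Linked⇒AllPairs (λ z≤y y≤x → ℕ.≤-trans y≤x z≤y) decreasing)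
    ; conditions    = Conditions-↭ p↭rev conditions
    ; lower         = All-resp-↭ p↭rev positive
    ; lowerRepeated = λ v 2≤occ → All.lookup (All-resp-↭ p↭rev positive)
                        (occ⇒∈ v (reverse p) (ℕ.≤-trans (ℕ.n≤1+n 1) 2≤occ))
    }

-- imported only here: in scope, `+_` makes sections such as `(k +_)` ambiguous
open import Data.Integer using (+_)

theorem1 : (M N : ℕ) → Σ (List (List ℕ)) (λ L → Unique L × (∀ p → (p ∈ L) ⇔ (IsPartitionOf N p × length p ≡ M × Conditions p)) × (+ (length L) ≡ rhsCoeff M N))
theorem1 M N =
  map reverse L ,
  Unique.map⁺ List.reverse-injective (ascendingPartitions-unique M N) ,
  (λ p → mk⇔ to (from p)) ,
  trans (cong +_ (List.length-map reverse L)) (length-ascendingPartitions M N)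
  where
  L = ascendingPartitions M N
  to : ∀ {p} → p ∈ map reverse L → IsPartitionOf N p × length p ≡ M × Conditions p
  to p∈ with ∈-map⁻ reverse p∈
  ... | q , q∈ , refl = let m , n , parts≡M , adm , sum≡N = ∈-ascendingPartitions⁻ M N q∈
                        in  Admissible⇒IsPartitionOf adm parts≡M sum≡N
  from : ∀ p → IsPartitionOf N p × length p ≡ M × Conditions p → p ∈ map reverse L
  from p partition =
    let m , n , parts≡M , adm , sum≡N = IsPartitionOf⇒Admissible partition
    in  subst (_∈ map reverse L) (List.reverse-involutive p)
          (∈-map⁺ reverse (∈-ascendingPartitions⁺ N parts≡M adm sum≡N))
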